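{- Let $k,l\geq 2$, $t\geq 4l$ and $s\geq 1$ be integers, let $n$ be an integer and $p$ a prime. Let $\tau\geq0$ with $p^\tau\| k$ and let $\gamma=\tau+1$ if $p>2$, or if $p=2$ and $\tau=0$; and $\gamma=\tau+2$ if $p=2$ and $\tau>0$. Suppose that $s+3\geq \frac{p}{p-1}\gcd\big(k,p^\tau(p-1)\big)$ when $\gamma=\tau+1$, that $s+3\geq 2^{\tau+2}$ when $\gamma=\tau+2$ and $k>2$, and that $s\geq 2$ when $p=k=2$. Then $M_n(p^\gamma)>0$.
   Context: For $\mathbf{x}\in\mathbb{Z}^t$ put $T(\mathbf{x})=x_1^l+\dots+x_t^l$. For $h\geq 1$, $M_n(p^h)$ is the number of pairs $(\mathbf{y},\mathbf{X})$ with $\mathbf{y}=(y_1,\dots,y_4)\in[1,p^h]^4$ and $\mathbf{X}=(\mathbf{x}_1,\dots,\mathbf{x}_s)\in([1,p^h]^{t})^s$ (integer entries) such that $p\nmid y_1y_2$ and $$n\equiv\sum_{i=1}^4y_i^k+\sum_{i=1}^sT(\mathbf{x}_i)^k\pmod{p^h}.$$ -}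

module Defs where

open import Data.Nat using (ℕ; zero; suc; _+_; _*_; _^_; _≤_; _<_)
open import Data.Nat.Divisibility using (_∣_; _∣?_)
open import Data.Integer as ℤ using (ℤ; +_; ∣_∣)
open import Data.Fin using (Fin; zero; suc)
open import Data.Vec using (Vec; []; _∷_; lookup; sum; map)
open import Data.List as List using (List; []; _∷_; concatMap; filter; length; upTo)
open import Data.Product using (_×_; _,_; proj₁; proj₂)
open import Relation.Nullary using (¬_)
open import Relation.Nullary.Decidable using (_×-dec_; ¬?)

range1 : ℕ → List ℕ
range1 N = List.map suc (upTo N)

vecsOf : {A : Set} (m : ℕ) → List A → List (Vec A m)
vecsOf zero    xs = [] ∷ []
vecsOf (suc m) xs = concatMap (λ x → List.map (x ∷_) (vecsOf m xs)) xs

T : (l : ℕ) {t : ℕ} → Vec ℕ t → ℕ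
T l x = sum (map (λ xi → xi ^ l) x)

rhs : (k l : ℕ) {t s : ℕ} → Vec ℕ 4 → Vec (Vec ℕ t) s → ℕ
rhs k l y X = sum (map (λ yi → yi ^ k) y) + sum (map (λ xi → T l xi ^ k) X)

pairs : (t s N : ℕ) → List (Vec ℕ 4 × Vec (Vec ℕ t) s)
pairs t s N = concatMap (λ y → List.map (y ,_) (vecsOf s (vecsOf t (range1 N))))
                        (vecsOf 4 (range1 N))

-- The congruence of the integer n with the natural m modulo q is stated as
-- q ∣ |n - m| (equivalent to integer divisibility q ∣ n - m).
M : (k l t s : ℕ) (n : ℤ) (p h : ℕ) → ℕ
M k l t s n p h =
  length (filter
    (λ yX → ¬? (p ∣? (lookup (proj₁ yX) zero * lookup (proj₁ yX) (suc zero)))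
            ×-dec ((p ^ h) ∣? ∣ n ℤ.- + rhs k l (proj₁ yX) (proj₂ yX) ∣))
    (pairs t s (p ^ h)))

gamma : (p τ : ℕ) → ℕ
gamma 2 (suc τ) = suc τ + 2
gamma p τ       = τ + 1

-- Put q = p^γ and take y₂ = 1. Let H be the set of k-th powers of units modulo q and S the set of all
-- k-th powers (0 included). Then n - 1 has to lie in H + S + ⋯ + S with s + 2 summands S. The nonzero
-- elements of S are units, so Chowla's theorem (Cauchy–Davenport for ℤ/q) gives
-- |H + (s+2) S| ≥ min(q, (s+3) |H|), and the hypotheses on s say exactly that (s+3) |H| ≥ q: for
-- γ = τ + 1 through the Lagrange bound |H| ≥ (p - 1)/gcd(k/p^τ, p - 1), for γ = τ + 2 already with |H| ≥ 1.
-- Each summand of S after y₃^k and y₄^k is turned into some T(x)^k: the same Chowla argument modulo p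
-- shows every residue is a sum of t ≥ l l-th powers, and a ≡ b (mod p) implies a^k ≡ b^k (mod q) by
-- lifting the exponent. The case p = k = 2 is settled by hand modulo 8.

module Submission where

module Congruence where

  open import Data.Nat as ℕ using (ℕ; zero; suc; NonZero)
  import Data.Nat.Properties as ℕₚ
  import Data.Nat.Divisibility as ℕ∣
  open import Data.Nat.DivMod using (_%_; [m+kn]%n≡m%n)
  open import Data.Integer as ℤ using (ℤ; +_; _+_; _-_; _*_; -_; _^_; 0ℤ; _%ℕ_; _/ℕ_)
  import Data.Integer.Properties as ℤ
  open import Data.Integer.DivMod using (a≡a%ℕn+[a/ℕn]*n)
  open import Data.Integer.Divisibility.Signed
    using (_∣_; divides; ∣-trans; ∣m∣n⇒∣m+n; ∣m⇒∣-m; ∣n⇒∣m*n; ∣m⇒∣m*n; ∣⇒∣ᵤ; ∣ᵤ⇒∣)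
  open import Data.Integer.Tactic.RingSolver using (solve-∀)
  open import Data.Vec using (Vec; []; _∷_; sum; map)
  open import Data.Sum using (inj₁; inj₂)
  open import Relation.Binary.Bundles using (Setoid)
  open import Relation.Binary.PropositionalEquality
  import Relation.Binary.Reasoning.Setoid as SetoidReasoning

  infix 4 _≡ᶻ_mod_ _≡_mod_

  record _≡ᶻ_mod_ (x y : ℤ) (m : ℕ) : Set where
    constructor mod-by
    field modulus∣difference : + m ∣ x - y
  open _≡ᶻ_mod_ public

  _≡_mod_ : ℕ → ℕ → ℕ → Set
  a ≡ b mod m = + a ≡ᶻ + b mod m

  module _ {m : ℕ} where

    ≡ᶻ-reflexive : ∀ {x y} → x ≡ y → x ≡ᶻ y mod m
    ≡ᶻ-reflexive {x} refl = mod-by (divides 0ℤ (trans (ℤ.+-inverseʳ x) (sym (ℤ.*-zeroˡ (+ m)))))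

    ≡ᶻ-refl : ∀ {x} → x ≡ᶻ x mod m
    ≡ᶻ-refl = ≡ᶻ-reflexive refl

    ≡ᶻ-sym : ∀ {x y} → x ≡ᶻ y mod m → y ≡ᶻ x mod m
    ≡ᶻ-sym {x} {y} (mod-by d) = mod-by (subst (+ m ∣_) (negate x y) (∣m⇒∣-m d))
      where negate : ∀ x y → - (x - y) ≡ y - x
            negate = solve-∀

    ≡ᶻ-trans : ∀ {x y z} → x ≡ᶻ y mod m → y ≡ᶻ z mod m → x ≡ᶻ z mod m
    ≡ᶻ-trans {x} {y} {z} (mod-by d₁) (mod-by d₂) = mod-by (subst (+ m ∣_) (telescope x y z) (∣m∣n⇒∣m+n d₁ d₂))
      where telescope : ∀ x y z → (x - y) + (y - z) ≡ x - z
            telescope = solve-∀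

    +-congᶻ : ∀ {x y u v} → x ≡ᶻ y mod m → u ≡ᶻ v mod m → x + u ≡ᶻ y + v mod m
    +-congᶻ {x} {y} {u} {v} (mod-by d₁) (mod-by d₂) = mod-by (subst (+ m ∣_) (regroup x y u v) (∣m∣n⇒∣m+n d₁ d₂))
      where regroup : ∀ x y u v → (x - y) + (u - v) ≡ (x + u) - (y + v)
            regroup = solve-∀

    *-congᶻ : ∀ {x y u v} → x ≡ᶻ y mod m → u ≡ᶻ v mod m → x * u ≡ᶻ y * v mod m
    *-congᶻ {x} {y} {u} {v} (mod-by d₁) (mod-by d₂) =
      mod-by (subst (+ m ∣_) (regroup x y u v) (∣m∣n⇒∣m+n (∣n⇒∣m*n x d₂) (∣m⇒∣m*n v d₁)))
      where regroup : ∀ x y u v → x * (u - v) + (x - y) * v ≡ x * u - y * v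
            regroup = solve-∀

    ^-congᶻ : ∀ {x y} n → x ≡ᶻ y mod m → x ^ n ≡ᶻ y ^ n mod m
    ^-congᶻ zero    _   = ≡ᶻ-refl
    ^-congᶻ (suc n) x≡y = *-congᶻ x≡y (^-congᶻ n x≡y)

    ∣⇒≡ᶻ0 : ∀ {x} → + m ∣ x → x ≡ᶻ 0ℤ mod m
    ∣⇒≡ᶻ0 {x} d = mod-by (subst (+ m ∣_) (sym (ℤ.+-identityʳ x)) d)

    ≡ᶻ0⇒∣ : ∀ {x} → x ≡ᶻ 0ℤ mod m → + m ∣ x
    ≡ᶻ0⇒∣ {x} (mod-by d) = subst (+ m ∣_) (ℤ.+-identityʳ x) d

  ≡ᶻ-subst : ∀ {m m′ x x′ y y′} → x ≡ x′ → y ≡ y′ → m ≡ m′ → x ≡ᶻ y mod m → x′ ≡ᶻ y′ mod m′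
  ≡ᶻ-subst refl refl refl h = h

  ≡ᶻ-weaken : ∀ {m d x y} → d ℕ∣.∣ m → x ≡ᶻ y mod m → x ≡ᶻ y mod d
  ≡ᶻ-weaken d∣m (mod-by m∣x-y) = mod-by (∣-trans (∣ᵤ⇒∣ d∣m) m∣x-y)

  ≡ᶻ-%ℕ : ∀ x m .{{_ : NonZero m}} → x ≡ᶻ + (x %ℕ m) mod m
  ≡ᶻ-%ℕ x m = mod-by (divides (x /ℕ m) (begin
      x - + (x %ℕ m)                           ≡⟨ cong (_- + (x %ℕ m)) (a≡a%ℕn+[a/ℕn]*n x m) ⟩
      (+ (x %ℕ m) + x /ℕ m * + m) - + (x %ℕ m)  ≡⟨ cancel (+ (x %ℕ m)) (x /ℕ m * + m) ⟩
      x /ℕ m * + m                             ∎))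
    where open ≡-Reasoning
          cancel : ∀ r y → (r + y) - r ≡ y
          cancel = solve-∀

  pos-^ : ∀ a n → + (a ℕ.^ n) ≡ (+ a) ^ n
  pos-^ a zero    = refl
  pos-^ a (suc n) = trans (ℤ.pos-* a (a ℕ.^ n)) (cong (+ a *_) (pos-^ a n))

  module _ {m : ℕ} where

    mod-reflexive : ∀ {a b} → a ≡ b → a ≡ b mod m
    mod-reflexive e = ≡ᶻ-reflexive (cong +_ e)

    mod-refl : ∀ {a} → a ≡ a mod m
    mod-refl = ≡ᶻ-refl

    mod-sym : ∀ {a b} → a ≡ b mod m → b ≡ a mod m
    mod-sym = ≡ᶻ-sym

    mod-trans : ∀ {a b c} → a ≡ b mod m → b ≡ c mod m → a ≡ c mod m
    mod-trans = ≡ᶻ-trans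

    private
      transport : ∀ {x y a b} → x ≡ + a → y ≡ + b → x ≡ᶻ y mod m → a ≡ b mod m
      transport refl refl h = h

    +-cong-mod : ∀ {a b c d} → a ≡ b mod m → c ≡ d mod m → a ℕ.+ c ≡ b ℕ.+ d mod m
    +-cong-mod {a} {b} {c} {d} h₁ h₂ = transport (sym (ℤ.pos-+ a c)) (sym (ℤ.pos-+ b d)) (+-congᶻ h₁ h₂)

    *-cong-mod : ∀ {a b c d} → a ≡ b mod m → c ≡ d mod m → a ℕ.* c ≡ b ℕ.* d mod m
    *-cong-mod {a} {b} {c} {d} h₁ h₂ = transport (sym (ℤ.pos-* a c)) (sym (ℤ.pos-* b d)) (*-congᶻ h₁ h₂)

    ^-cong-mod : ∀ {a b} n → a ≡ b mod m → a ℕ.^ n ≡ b ℕ.^ n mod m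
    ^-cong-mod {a} {b} n h = transport (sym (pos-^ a n)) (sym (pos-^ b n)) (^-congᶻ n h)

    sum-map-cong-mod : ∀ {j} {A : Set} (g h : A → ℕ) (v : Vec A j) → (∀ z → g z ≡ h z mod m) →
                       sum (map g v) ≡ sum (map h v) mod m
    sum-map-cong-mod g h []      _   = mod-refl
    sum-map-cong-mod g h (z ∷ v) g≡h = +-cong-mod (g≡h z) (sum-map-cong-mod g h v g≡h)

    ∣⇒≡0-mod : ∀ {a} → m ℕ∣.∣ a → a ≡ 0 mod m
    ∣⇒≡0-mod d = ∣⇒≡ᶻ0 (∣ᵤ⇒∣ d)

    ≡0-mod⇒∣ : ∀ {a} → a ≡ 0 mod m → m ℕ∣.∣ a
    ≡0-mod⇒∣ h = ∣⇒∣ᵤ (≡ᶻ0⇒∣ h)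

    multiple≡0-mod : ∀ j → j ℕ.* m ≡ 0 mod m
    multiple≡0-mod j = ∣⇒≡0-mod (ℕ∣.divides j refl)

  mod-setoid : ℕ → Setoid _ _
  mod-setoid m = record
    { Carrier = ℕ
    ; _≈_ = λ a b → a ≡ b mod m
    ; isEquivalence = record { refl = mod-refl ; sym = mod-sym ; trans = mod-trans }
    }

  module ≡-mod-Reasoning (m : ℕ) = SetoidReasoning (mod-setoid m)

  ≡-mod-% : ∀ a m .{{_ : NonZero m}} → a ≡ a % m mod m
  ≡-mod-% a m = ≡ᶻ-%ℕ (+ a) m

  private
    ≡-mod⇒%≡-≤ : ∀ m a b .{{_ : NonZero m}} → b ℕ.≤ a → a ≡ b mod m → a % m ≡ b % m
    ≡-mod⇒%≡-≤ m a b b≤a (mod-by h) with ∣⇒∣ᵤ h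
    ... | ℕ∣.divides j eq = begin
        a % m                   ≡⟨ cong (_% m) (sym (ℕₚ.m+[n∸m]≡n b≤a)) ⟩
        (b ℕ.+ (a ℕ.∸ b)) % m   ≡⟨ cong (λ u → (b ℕ.+ u) % m) a∸b≡j*m ⟩
        (b ℕ.+ j ℕ.* m) % m     ≡⟨ [m+kn]%n≡m%n b j m ⟩
        b % m                   ∎
      where
        open ≡-Reasoning
        a∸b≡j*m : a ℕ.∸ b ≡ j ℕ.* m
        a∸b≡j*m = trans (sym (cong ℤ.∣_∣ (trans (ℤ.m-n≡m⊖n a b) (ℤ.⊖-≥ b≤a)))) eq

  ≡-mod⇒%≡ : ∀ m a b .{{_ : NonZero m}} → a ≡ b mod m → a % m ≡ b % m
  ≡-mod⇒%≡ m a b h with ℕₚ.≤-total b a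
  ... | inj₁ b≤a = ≡-mod⇒%≡-≤ m a b b≤a h
  ... | inj₂ a≤b = sym (≡-mod⇒%≡-≤ m b a a≤b (mod-sym h))

  %≡⇒≡-mod : ∀ m a b .{{_ : NonZero m}} → a % m ≡ b % m → a ≡ b mod m
  %≡⇒≡-mod m a b e = mod-trans (≡-mod-% a m) (mod-trans (mod-reflexive e) (mod-sym (≡-mod-% b m)))

module LiftingTheExponent where

  open import Data.Nat as ℕ using (ℕ; zero; suc)
  import Data.Nat.Properties as ℕₚ
  import Data.Nat.Divisibility as ℕ∣
  open import Data.Integer as ℤ using (ℤ; +_; _+_; _-_; _*_; _^_; 0ℤ; 1ℤ)
  import Data.Integer.Properties as ℤ
  open import Data.Integer.Divisibility.Signed using (divides; _∣_; ∣-refl; ∣m⇒∣m*n)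
  open import Data.Integer.Tactic.RingSolver using (solve-∀)
  open import Relation.Binary.PropositionalEquality
  open Congruence

  geometricSum : ℤ → ℤ → ℕ → ℤ
  geometricSum a b zero    = 0ℤ
  geometricSum a b (suc n) = a ^ n + b * geometricSum a b n

  difference-of-powers : ∀ a b n → a ^ n - b ^ n ≡ (a - b) * geometricSum a b n
  difference-of-powers a b zero = both-zero a b
    where both-zero : ∀ a b → 1ℤ - 1ℤ ≡ (a - b) * 0ℤ
          both-zero = solve-∀
  difference-of-powers a b (suc n) = begin
      a * a ^ n - b * b ^ n
        ≡⟨ expand a b (a ^ n) (b ^ n) G ⟩
      (a - b) * (a ^ n + b * G) + b * ((a ^ n - b ^ n) - (a - b) * G)
        ≡⟨ cong (λ u → (a - b) * (a ^ n + b * G) + b * (u - (a - b) * G)) (difference-of-powers a b n) ⟩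
      (a - b) * (a ^ n + b * G) + b * ((a - b) * G - (a - b) * G)
        ≡⟨ cancel ((a - b) * (a ^ n + b * G)) b ((a - b) * G) ⟩
      (a - b) * (a ^ n + b * G) ∎
    where
      open ≡-Reasoning
      G : ℤ
      G = geometricSum a b n
      expand : ∀ a b x y g → a * x - b * y ≡ (a - b) * (x + b * g) + b * ((x - y) - (a - b) * g)
      expand = solve-∀
      cancel : ∀ u b w → u + b * (w - w) ≡ u
      cancel = solve-∀

  geometricSum-≡ᶻ : ∀ {m a b} → a ≡ᶻ b mod m → ∀ n → geometricSum a b (suc n) ≡ᶻ + suc n * b ^ n mod m
  geometricSum-≡ᶻ {b = b} _ zero = ≡ᶻ-reflexive (one b)
    where one : ∀ b → 1ℤ + b * 0ℤ ≡ 1ℤ * 1ℤ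
          one = solve-∀
  geometricSum-≡ᶻ {b = b} a≡b (suc n) =
    ≡ᶻ-trans (+-congᶻ (^-congᶻ (suc n) a≡b) (*-congᶻ (≡ᶻ-refl {x = b}) (geometricSum-≡ᶻ a≡b n)))
             (≡ᶻ-reflexive (collect b (b ^ n) (+ suc n)))
    where collect : ∀ b B N → b * B + b * (N * B) ≡ (1ℤ + N) * (b * B)
          collect = solve-∀

  -- a^p - b^p = (a - b) G with G ≡ p b^(p-1) ≡ 0 (mod p), so raising to the power p gains a factor p.
  ^-lifts-≡ᶻ : ∀ p m {a b} → p ℕ∣.∣ m → a ≡ᶻ b mod m → a ^ p ≡ᶻ b ^ p mod (m ℕ.* p)
  ^-lifts-≡ᶻ zero    m _ _ = ≡ᶻ-refl
  ^-lifts-≡ᶻ (suc p) m {a} {b} p∣m a≡b@(mod-by (divides q₁ a-b≡q₁m)) = mod-by (divides (q₁ * q₂) (begin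
      a ^ suc p - b ^ suc p        ≡⟨ difference-of-powers a b (suc p) ⟩
      (a - b) * G                  ≡⟨ cong₂ _*_ a-b≡q₁m G≡q₂p ⟩
      (q₁ * + m) * (q₂ * + suc p)  ≡⟨ regroup q₁ q₂ (+ m) (+ suc p) ⟩
      (q₁ * q₂) * (+ m * + suc p)  ≡⟨ cong ((q₁ * q₂) *_) (sym (ℤ.pos-* m (suc p))) ⟩
      (q₁ * q₂) * + (m ℕ.* suc p)  ∎))
    where
      open ≡-Reasoning
      G : ℤ
      G = geometricSum a b (suc p)
      p∣G : + suc p ∣ G
      p∣G = ≡ᶻ0⇒∣ (≡ᶻ-trans (geometricSum-≡ᶻ (≡ᶻ-weaken p∣m a≡b) p) (∣⇒≡ᶻ0 (∣m⇒∣m*n (b ^ p) ∣-refl)))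
      q₂ : ℤ
      q₂ = _∣_.quotient p∣G
      G≡q₂p : G ≡ q₂ * + suc p
      G≡q₂p = _∣_.equality p∣G
      regroup : ∀ a b c d → (a * c) * (b * d) ≡ (a * b) * (c * d)
      regroup = solve-∀

  lifting-the-exponent : ∀ p τ j {a b} → a ≡ b mod (p ℕ.^ suc j) →
                         a ℕ.^ (p ℕ.^ τ) ≡ b ℕ.^ (p ℕ.^ τ) mod (p ℕ.^ (suc j ℕ.+ τ))
  lifting-the-exponent p zero j {a} {b} h =
    ≡ᶻ-subst (cong +_ (sym (ℕₚ.*-identityʳ a))) (cong +_ (sym (ℕₚ.*-identityʳ b)))
             (cong (p ℕ.^_) (sym (ℕₚ.+-identityʳ (suc j)))) h
  lifting-the-exponent p (suc τ) j {a} {b} h =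
    ≡ᶻ-subst (pos-power a) (pos-power b) modulus
      (^-lifts-≡ᶻ p (p ℕ.^ (suc j ℕ.+ τ)) (ℕ∣.m∣m*n (p ℕ.^ (j ℕ.+ τ))) (lifting-the-exponent p τ j h))
    where
      pos-power : ∀ x → (+ (x ℕ.^ (p ℕ.^ τ))) ^ p ≡ + (x ℕ.^ (p ℕ.^ suc τ))
      pos-power x = trans (sym (pos-^ (x ℕ.^ (p ℕ.^ τ)) p))
                      (cong +_ (trans (ℕₚ.^-*-assoc x (p ℕ.^ τ) p) (cong (x ℕ.^_) (ℕₚ.*-comm (p ℕ.^ τ) p))))
      modulus : p ℕ.^ (suc j ℕ.+ τ) ℕ.* p ≡ p ℕ.^ (suc j ℕ.+ suc τ)
      modulus = trans (ℕₚ.*-comm _ p) (cong (p ℕ.^_) (sym (ℕₚ.+-suc (suc j) τ)))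

module Primes where

  open import Data.Nat as ℕ using (ℕ; zero; suc; _*_; _^_; _∸_; _!; _<_; _≤_)
  import Data.Nat.Properties as ℕₚ
  open import Data.Nat.Divisibility as ℕ∣ using (_∣_)
  open import Data.Nat.DivMod using (m/n*n≡m)
  open import Data.Nat.Primality using (Prime; euclidsLemma; prime⇒nonTrivial)
  open import Data.Nat.Combinatorics using (_C_; nCk≡n!/k![n-k]!; k![n∸k]!∣n!)
  open import Data.Integer as ℤ using (ℤ; +_)
  import Data.Integer.Properties as ℤ
  import Data.Integer.Divisibility.Signed as ℤ∣
  open import Data.Sum using (_⊎_; inj₁; inj₂)
  open import Data.Empty using (⊥-elim)
  open import Relation.Nullary using (¬_)
  open import Relation.Binary.PropositionalEquality

  n∣n! : ∀ {n} → 0 < n → n ∣ n !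
  n∣n! {suc n} _ = ℕ∣.m∣m*n (n !)

  module _ {p : ℕ} (pr : Prime p) where

    prime≥2 : 2 ≤ p
    prime≥2 = ℕ.nonTrivial⇒n>1 p {{prime⇒nonTrivial pr}}

    prime∤1 : ¬ p ∣ 1
    prime∤1 p∣1 = ℕ.nonTrivial⇒≢1 {{prime⇒nonTrivial pr}} (ℕ∣.∣1⇒≡1 p∣1)

    prime∣^⇒∣ : ∀ x n → p ∣ x ^ n → p ∣ x
    prime∣^⇒∣ x zero    p∣1 = ⊥-elim (prime∤1 p∣1)
    prime∣^⇒∣ x (suc n) p∣x^n with euclidsLemma x (x ^ n) pr p∣x^n
    ... | inj₁ p∣x = p∣x
    ... | inj₂ p∣x^n = prime∣^⇒∣ x n p∣x^n

    prime∤! : ∀ m → m < p → ¬ p ∣ m !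
    prime∤! zero    _   p∣1 = prime∤1 p∣1
    prime∤! (suc m) m<p p∣m! with euclidsLemma (suc m) (m !) pr p∣m!
    ... | inj₁ p∣m  = ℕₚ.<⇒≱ m<p (ℕ∣.∣⇒≤ p∣m)
    ... | inj₂ p∣m! = prime∤! m (ℕₚ.<-trans (ℕₚ.n<1+n m) m<p) p∣m!

    -- p divides p! = (p C k) k! (p-k)! but neither factorial.
    prime∣C : ∀ {k} → 0 < k → k < p → p ∣ p C k
    prime∣C {k} 0<k k<p with euclidsLemma (p C k) (k ! * (p ∸ k) !) pr p∣p!
      where
        instance _ = k ℕₚ.!* (p ∸ k) !≢0
        p!≡C*k!*[p∸k]! : p ! ≡ (p C k) * (k ! * (p ∸ k) !)
        p!≡C*k!*[p∸k]! = sym (trans (cong (_* (k ! * (p ∸ k) !)) (nCk≡n!/k![n-k]! (ℕₚ.<⇒≤ k<p)))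
                                    (m/n*n≡m (k![n∸k]!∣n! (ℕₚ.<⇒≤ k<p))))
        p∣p! : p ∣ (p C k) * (k ! * (p ∸ k) !)
        p∣p! = subst (p ∣_) p!≡C*k!*[p∸k]! (n∣n! (ℕₚ.<-trans 0<k k<p))
    ... | inj₁ p∣C = p∣C
    ... | inj₂ p∣k!*[p∸k]! with euclidsLemma (k !) ((p ∸ k) !) pr p∣k!*[p∸k]!
    ...   | inj₁ p∣k! = ⊥-elim (prime∤! k k<p p∣k!)
    ...   | inj₂ p∣[p∸k]! = ⊥-elim (prime∤! (p ∸ k) (ℕₚ.∸-monoʳ-< 0<k (ℕₚ.<⇒≤ k<p)) p∣[p∸k]!)

    euclidsLemmaᶻ : ∀ a b → + p ℤ∣.∣ a ℤ.* b → + p ℤ∣.∣ a ⊎ + p ℤ∣.∣ b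
    euclidsLemmaᶻ a b p∣ab with euclidsLemma ℤ.∣ a ∣ ℤ.∣ b ∣ pr (subst (p ∣_) (ℤ.abs-* a b) (ℤ∣.∣⇒∣ᵤ p∣ab))
    ... | inj₁ p∣a = inj₁ (ℤ∣.∣ᵤ⇒∣ p∣a)
    ... | inj₂ p∣b = inj₂ (ℤ∣.∣ᵤ⇒∣ p∣b)

module FermatsLittleTheorem where

  open import Data.Nat as ℕ using (ℕ; zero; suc; _+_; _*_; _^_; _∸_; _<_; s≤s)
  import Data.Nat.Properties as ℕₚ
  open import Data.Nat.Divisibility as ℕ∣ using (_∣_)
  open import Data.Nat.Primality using (Prime; ¬prime[0]; ¬prime[1])
  open import Data.Nat.Combinatorics using (_C_; nCn≡1)
  open import Data.Fin using (Fin; zero; suc; toℕ; inject₁; fromℕ)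
  import Data.Fin.Properties as Finₚ
  open import Data.Vec.Functional using (init; tail; last)
  import Algebra.Properties.CommutativeSemiring.Binomial ℕₚ.+-*-commutativeSemiring as Binomial
  open import Algebra.Properties.Monoid.Sum ℕₚ.+-0-monoid using (sum; sum-init-last)
  open import Algebra.Definitions.RawSemiring ℕ.+-*-rawSemiring using (_×_) renaming (_^_ to _^ₛ_)
  open import Data.Empty using (⊥-elim)
  open import Relation.Binary.PropositionalEquality
  open Congruence
  open Primes

  private
    ×≡* : ∀ n x → n × x ≡ n * x
    ×≡* zero    x = refl
    ×≡* (suc n) x = cong (x +_) (×≡* n x)

    ^ₛ≡^ : ∀ x n → x ^ₛ n ≡ x ^ n
    ^ₛ≡^ x zero    = refl
    ^ₛ≡^ x (suc n) = cong (x *_) (^ₛ≡^ x n)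

    binomialTerm-with-1 : ∀ n x k → (n C k) × (x ^ₛ k * 1 ^ₛ (n ∸ k)) ≡ (n C k) * x ^ k
    binomialTerm-with-1 n x k = begin
        (n C k) × (x ^ₛ k * 1 ^ₛ (n ∸ k)) ≡⟨ ×≡* (n C k) _ ⟩
        (n C k) * (x ^ₛ k * 1 ^ₛ (n ∸ k)) ≡⟨ cong₂ (λ u v → (n C k) * (u * v))
                                               (^ₛ≡^ x k) (trans (^ₛ≡^ 1 (n ∸ k)) (ℕₚ.^-zeroˡ (n ∸ k))) ⟩
        (n C k) * (x ^ k * 1)              ≡⟨ cong ((n C k) *_) (ℕₚ.*-identityʳ (x ^ k)) ⟩
        (n C k) * x ^ k                    ∎
      where open ≡-Reasoning

  ∣-sum : ∀ {d n} (u : Fin n → ℕ) → (∀ i → d ∣ u i) → d ∣ sum u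
  ∣-sum {n = zero}  u _ = ℕ∣._∣0 _
  ∣-sum {n = suc n} u d∣u = ℕ∣.∣m∣n⇒∣m+n (d∣u zero) (∣-sum (tail u) (λ i → d∣u (suc i)))

  sum≡ends-mod : ∀ {d} n (t : Fin (suc (suc n)) → ℕ) → (∀ i → d ∣ t (suc (inject₁ i))) →
                 sum t ≡ t zero + t (fromℕ (suc n)) mod d
  sum≡ends-mod {d} n t d∣middle = begin
      t zero + sum (tail t)                                 ≡⟨ cong (t zero +_) (sum-init-last (tail t)) ⟩
      t zero + (sum (init (tail t)) + last (tail t))        ≈⟨ +-cong-mod (mod-refl {a = t zero}) (+-cong-mod middle≡0 mod-refl) ⟩
      t zero + (0 + last (tail t))                          ≡⟨⟩
      t zero + t (fromℕ (suc n))                            ∎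
    where
      open ≡-mod-Reasoning d
      middle≡0 : sum (init (tail t)) ≡ 0 mod d
      middle≡0 = ∣⇒≡0-mod (∣-sum (init (tail t)) d∣middle)

  freshmans-dream : ∀ {p} → Prime p → ∀ x → (x + 1) ^ p ≡ x ^ p + 1 mod p
  freshmans-dream {0} pr = ⊥-elim (¬prime[0] pr)
  freshmans-dream {1} pr = ⊥-elim (¬prime[1] pr)
  freshmans-dream {p@(suc (suc n))} pr x = begin
      (x + 1) ^ p                                  ≡⟨ ^ₛ≡^ (x + 1) p ⟨
      (x + 1) ^ₛ p                                 ≡⟨ Binomial.theorem p x 1 ⟩
      Binomial.binomialExpansion x 1 p             ≈⟨ sum≡ends-mod (suc n) (Binomial.binomialTerm x 1 p) p∣middle ⟩
      term 0 + term (toℕ (fromℕ p))                ≡⟨ cong₂ _+_ (term≡ 0) (trans (cong term (Finₚ.toℕ-fromℕ p)) (term≡ p)) ⟩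
      (p C 0) * 1 + (p C p) * x ^ p                ≡⟨ cong (λ c → 1 + c * x ^ p) (nCn≡1 p) ⟩
      1 + 1 * x ^ p                                ≡⟨ cong (1 +_) (ℕₚ.*-identityˡ (x ^ p)) ⟩
      1 + x ^ p                                    ≡⟨ ℕₚ.+-comm 1 (x ^ p) ⟩
      x ^ p + 1                                    ∎
    where
      open ≡-mod-Reasoning p
      term : ℕ → ℕ
      term k = (p C k) × (x ^ₛ k * 1 ^ₛ (p ∸ k))
      term≡ : ∀ k → term k ≡ (p C k) * x ^ k
      term≡ = binomialTerm-with-1 p x
      p∣middle : ∀ i → p ∣ term (toℕ (suc (inject₁ i)))
      p∣middle i = subst (p ∣_) (sym (term≡ k)) (ℕ∣.∣m⇒∣m*n (x ^ k) (prime∣C pr (s≤s ℕ.z≤n) k<p))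
        where
          k : ℕ
          k = suc (toℕ (inject₁ i))
          k<p : k < p
          k<p = s≤s (subst (_< suc n) (sym (Finₚ.toℕ-inject₁ i)) (Finₚ.toℕ<n i))

  fermat : ∀ {p} → Prime p → ∀ x → x ^ p ≡ x mod p
  fermat {zero}  pr _       = ⊥-elim (¬prime[0] pr)
  fermat {suc _} pr zero    = mod-refl
  fermat {p@(suc _)} pr (suc x) = begin
      suc x ^ p        ≡⟨ cong (_^ p) (ℕₚ.+-comm 1 x) ⟩
      (x + 1) ^ p      ≈⟨ freshmans-dream pr x ⟩
      x ^ p + 1        ≈⟨ +-cong-mod (fermat pr x) mod-refl ⟩
      x + 1            ≡⟨ ℕₚ.+-comm x 1 ⟩
      suc x            ∎
    where open ≡-mod-Reasoning p

module PowersModuloPrimes where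

  open import Data.Nat using (ℕ; zero; suc; _+_; _*_; _^_; _∸_; _≤_; s≤s; z≤n)
  import Data.Nat.Properties as ℕₚ
  open import Data.Nat.Divisibility as ℕ∣ using (_∣_)
  open import Data.Nat.Primality using (Prime; prime⇒nonZero)
  open import Data.Nat.GCD using (gcd; gcd-GCD; module Bézout)
  open import Data.Integer as ℤ using (+_)
  import Data.Integer.Properties as ℤ
  import Data.Integer.Divisibility.Signed as ℤ∣
  open import Data.Integer.Tactic.RingSolver using (solve-∀)
  open import Data.Product using (Σ; _,_)
  open import Data.Sum using (inj₁; inj₂)
  open import Data.Empty using (⊥-elim)
  open import Relation.Nullary using (¬_)
  open import Relation.Binary.PropositionalEquality
  open Congruence
  open LiftingTheExponent using (lifting-the-exponent)
  open Primes
  open FermatsLittleTheorem using (fermat)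

  module _ {p : ℕ} (pr : Prime p) where

    private
      instance _ = prime⇒nonZero pr
      p≥1 : 1 ≤ p
      p≥1 = ℕₚ.<-trans (s≤s z≤n) (prime≥2 pr)

    cancel-mod : ∀ {a b c} → ¬ p ∣ c → a * c ≡ b * c mod p → a ≡ b mod p
    cancel-mod {a} {b} {c} p∤c (mod-by p∣ac-bc) with euclidsLemmaᶻ pr (+ a ℤ.- + b) (+ c) (subst (+ p ℤ∣.∣_) factor p∣ac-bc)
      where
        distrib : ∀ a b c → a ℤ.* c ℤ.- b ℤ.* c ≡ (a ℤ.- b) ℤ.* c
        distrib = solve-∀
        factor : + (a * c) ℤ.- + (b * c) ≡ (+ a ℤ.- + b) ℤ.* + c
        factor = trans (cong₂ ℤ._-_ (ℤ.pos-* a c) (ℤ.pos-* b c)) (distrib (+ a) (+ b) (+ c))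
    ... | inj₁ p∣a-b = mod-by p∣a-b
    ... | inj₂ p∣c   = ⊥-elim (p∤c (ℤ∣.∣⇒∣ᵤ p∣c))

    fermat-unit : ∀ {x} → ¬ p ∣ x → x ^ (p ∸ 1) ≡ 1 mod p
    fermat-unit {x} p∤x = cancel-mod p∤x (begin
        x ^ (p ∸ 1) * x  ≡⟨ trans (ℕₚ.*-comm _ x) (cong (x ^_) (trans (ℕₚ.+-comm 1 (p ∸ 1)) (ℕₚ.m∸n+n≡m p≥1))) ⟩
        x ^ p            ≈⟨ fermat pr x ⟩
        x                ≡⟨ ℕₚ.*-identityˡ x ⟨
        1 * x            ∎)
      where open ≡-mod-Reasoning p

    fermat-iterated : ∀ τ x → x ^ (p ^ τ) ≡ x mod p
    fermat-iterated zero    x = mod-reflexive (ℕₚ.*-identityʳ x)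
    fermat-iterated (suc τ) x = begin
        x ^ (p ^ suc τ)    ≡⟨ trans (cong (x ^_) (ℕₚ.*-comm p (p ^ τ))) (sym (ℕₚ.^-*-assoc x (p ^ τ) p)) ⟩
        (x ^ (p ^ τ)) ^ p  ≈⟨ ^-cong-mod p (fermat-iterated τ x) ⟩
        x ^ p              ≈⟨ fermat pr x ⟩
        x                  ∎
      where open ≡-mod-Reasoning p

    power-lifts : ∀ τ {a b} → a ≡ b mod p → a ^ (p ^ τ) ≡ b ^ (p ^ τ) mod (p ^ suc τ)
    power-lifts τ a≡b = lifting-the-exponent p τ 0 (≡ᶻ-subst refl refl (sym (ℕₚ.*-identityʳ p)) a≡b)

    ^-lifts-mod-prime : ∀ τ {k} → p ^ τ ∣ k → ∀ {a b} → a ≡ b mod p → a ^ k ≡ b ^ k mod (p ^ suc τ)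
    ^-lifts-mod-prime τ (ℕ∣.divides k₀ refl) {a} {b} a≡b = begin
        a ^ (k₀ * p ^ τ)    ≡⟨ split a ⟩
        (a ^ (p ^ τ)) ^ k₀  ≈⟨ ^-cong-mod k₀ (power-lifts τ a≡b) ⟩
        (b ^ (p ^ τ)) ^ k₀  ≡⟨ split b ⟨
        b ^ (k₀ * p ^ τ)    ∎
      where
        open ≡-mod-Reasoning (p ^ suc τ)
        split : ∀ x → x ^ (k₀ * p ^ τ) ≡ (x ^ (p ^ τ)) ^ k₀
        split x = trans (cong (x ^_) (ℕₚ.*-comm k₀ (p ^ τ))) (sym (ℕₚ.^-*-assoc x (p ^ τ) k₀))

    -- Euler: the unit group modulo p^(g+1) has exponent (p-1) p^g.
    unit-inverse : ∀ g {z} → ¬ p ∣ z → Σ ℕ λ u → z * u ≡ 1 mod (p ^ suc g)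
    unit-inverse g {z} p∤z = z ^ (N ∸ 1) , (begin
        z * z ^ (N ∸ 1)              ≡⟨ cong (z ^_) (trans (ℕₚ.+-comm 1 (N ∸ 1)) (ℕₚ.m∸n+n≡m N≥1)) ⟩
        z ^ N                        ≡⟨ ℕₚ.^-*-assoc z (p ∸ 1) (p ^ g) ⟨
        (z ^ (p ∸ 1)) ^ (p ^ g)      ≈⟨ power-lifts g (fermat-unit p∤z) ⟩
        1 ^ (p ^ g)                  ≡⟨ ℕₚ.^-zeroˡ (p ^ g) ⟩
        1                            ∎)
      where
        open ≡-mod-Reasoning (p ^ suc g)
        N : ℕ
        N = (p ∸ 1) * p ^ g
        N≥1 : 1 ≤ N
        N≥1 = ℕₚ.*-mono-≤ {1} {p ∸ 1} {1} (ℕₚ.∸-monoˡ-≤ 1 (prime≥2 pr)) (ℕₚ.m^n>0 p g)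

    private
      unit^≡1 : ∀ z {w} → ¬ p ∣ w → (w ^ (p ∸ 1)) ^ z ≡ 1 mod p
      unit^≡1 z p∤w = mod-trans (^-cong-mod z (fermat-unit p∤w)) (mod-reflexive (ℕₚ.^-zeroˡ z))

      ^-* : ∀ w m n → w ^ (n * m) ≡ (w ^ m) ^ n
      ^-* w m n = trans (cong (w ^_) (ℕₚ.*-comm n m)) (sym (ℕₚ.^-*-assoc w m n))

    -- By Bézout, d = gcd a (p - 1) and a x differ by a multiple of p - 1, which Fermat ignores.
    ^-≡-mod-gcd : ∀ a {y y₀} → ¬ p ∣ y → ¬ p ∣ y₀ → y ^ a ≡ y₀ ^ a mod p →
                  y ^ gcd a (p ∸ 1) ≡ y₀ ^ gcd a (p ∸ 1) mod p
    ^-≡-mod-gcd a {y} {y₀} p∤y p∤y₀ yᵃ≡y₀ᵃ with Bézout.identity (gcd-GCD a (p ∸ 1))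
    ... | Bézout.+- x z d+z[p-1]≡xa = begin
        y ^ d                             ≈⟨ strip y p∤y ⟨
        y ^ d * (y ^ (p ∸ 1)) ^ z         ≡⟨ combine y ⟩
        (y ^ a) ^ x                       ≈⟨ ^-cong-mod x yᵃ≡y₀ᵃ ⟩
        (y₀ ^ a) ^ x                      ≡⟨ combine y₀ ⟨
        y₀ ^ d * (y₀ ^ (p ∸ 1)) ^ z       ≈⟨ strip y₀ p∤y₀ ⟩
        y₀ ^ d                            ∎
      where
        open ≡-mod-Reasoning p
        d : ℕ
        d = gcd a (p ∸ 1)
        strip : ∀ w → ¬ p ∣ w → w ^ d * (w ^ (p ∸ 1)) ^ z ≡ w ^ d mod p
        strip w p∤w = mod-trans (*-cong-mod (mod-refl {a = w ^ d}) (unit^≡1 z p∤w)) (mod-reflexive (ℕₚ.*-identityʳ (w ^ d)))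
        combine : ∀ w → w ^ d * (w ^ (p ∸ 1)) ^ z ≡ (w ^ a) ^ x
        combine w = trans (cong (w ^ d *_) (sym (^-* w (p ∸ 1) z)))
                      (trans (sym (ℕₚ.^-distribˡ-+-* w d (z * (p ∸ 1)))) (trans (cong (w ^_) d+z[p-1]≡xa) (^-* w a x)))
    ... | Bézout.-+ x z d+xa≡z[p-1] = cancel-mod p∤y₀ᵃˣ (begin
        y ^ d * (y₀ ^ a) ^ x              ≈⟨ *-cong-mod (mod-refl {a = y ^ d}) (^-cong-mod x yᵃ≡y₀ᵃ) ⟨
        y ^ d * (y ^ a) ^ x               ≈⟨ ≡1 y p∤y ⟩
        1                                 ≈⟨ ≡1 y₀ p∤y₀ ⟨
        y₀ ^ d * (y₀ ^ a) ^ x             ∎)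
      where
        open ≡-mod-Reasoning p
        d : ℕ
        d = gcd a (p ∸ 1)
        ≡1 : ∀ w → ¬ p ∣ w → w ^ d * (w ^ a) ^ x ≡ 1 mod p
        ≡1 w p∤w = begin
            w ^ d * (w ^ a) ^ x    ≡⟨ cong (w ^ d *_) (sym (^-* w a x)) ⟩
            w ^ d * w ^ (x * a)    ≡⟨ ℕₚ.^-distribˡ-+-* w d (x * a) ⟨
            w ^ (d + x * a)        ≡⟨ trans (cong (w ^_) d+xa≡z[p-1]) (^-* w (p ∸ 1) z) ⟩
            (w ^ (p ∸ 1)) ^ z      ≈⟨ unit^≡1 z p∤w ⟩
            1                      ∎
        p∤y₀ᵃˣ : ¬ p ∣ (y₀ ^ a) ^ x
        p∤y₀ᵃˣ p∣ = p∤y₀ (prime∣^⇒∣ pr y₀ (x * a) (subst (p ∣_) (sym (^-* y₀ a x)) p∣))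

module Counting where

  open import Data.Nat as ℕ using (ℕ; zero; suc; _+_; _*_; _≤_; _<_; z≤n; s≤s; _≡ᵇ_)
  import Data.Nat.Properties as ℕₚ
  open import Data.Nat.Tactic.RingSolver using (solve-∀)
  open import Data.Bool as Bool using (Bool; true; false; _∨_; _∧_; not; T)
  open import Data.Sum using (_⊎_; inj₁; inj₂)
  open import Data.Product using (∃; _×_; _,_)
  open import Data.Unit using (tt)
  open import Data.Empty using (⊥-elim)
  open import Relation.Nullary using (yes; no)
  open import Relation.Nullary.Decidable using (isYes)
  open import Relation.Binary.PropositionalEquality
  open import Function using (_∘_)

  ≡ᵇ-sound : ∀ m n → (m ≡ᵇ n) ≡ true → m ≡ n
  ≡ᵇ-sound m n e = ℕₚ.≡ᵇ⇒≡ m n (subst T (sym e) tt)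

  ≡ᵇ-refl : ∀ m → (m ≡ᵇ m) ≡ true
  ≡ᵇ-refl zero    = refl
  ≡ᵇ-refl (suc m) = ≡ᵇ-refl m

  ≡ᵇ-complete : ∀ {m n} → m ≡ n → (m ≡ᵇ n) ≡ true
  ≡ᵇ-complete {m} refl = ≡ᵇ-refl m

  ≡ᵇ-false : ∀ {m n} → m ≢ n → (m ≡ᵇ n) ≡ false
  ≡ᵇ-false {m} {n} m≢n with m ≡ᵇ n in e
  ... | false = refl
  ... | true  = ⊥-elim (m≢n (≡ᵇ-sound m n e))

  ∧-elim : ∀ {a b} → a ∧ b ≡ true → a ≡ true × b ≡ true
  ∧-elim {true} {true} _ = refl , refl

  ∧-intro : ∀ {a b} → a ≡ true → b ≡ true → a ∧ b ≡ true
  ∧-intro refl refl = refl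

  ∨-elim : ∀ {a b} → a ∨ b ≡ true → a ≡ true ⊎ b ≡ true
  ∨-elim {true}          _ = inj₁ refl
  ∨-elim {false} {true}  _ = inj₂ refl

  ∨-introˡ : ∀ {a} b → a ≡ true → a ∨ b ≡ true
  ∨-introˡ b refl = refl

  ∨-introʳ : ∀ a {b} → b ≡ true → a ∨ b ≡ true
  ∨-introʳ true  refl = refl
  ∨-introʳ false refl = refl

  not≡true : ∀ {a} → not a ≡ true → a ≡ false
  not≡true {false} _ = refl

  false≢true : ∀ {a} → a ≡ false → a ≢ true
  false≢true refl ()

  anyBelow : ℕ → (ℕ → Bool) → Bool
  anyBelow n P = isYes (ℕₚ.anyUpTo? (λ x → P x Bool.≟ true) n)

  anyBelow-sound : ∀ n P → anyBelow n P ≡ true → ∃ λ x → x < n × P x ≡ true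
  anyBelow-sound n P e with ℕₚ.anyUpTo? (λ x → P x Bool.≟ true) n
  ... | yes witness = witness

  anyBelow-complete : ∀ n P x → x < n → P x ≡ true → anyBelow n P ≡ true
  anyBelow-complete n P x x<n Px with ℕₚ.anyUpTo? (λ x → P x Bool.≟ true) n
  ... | yes _     = refl
  ... | no ¬found = ⊥-elim (¬found (x , x<n , Px))

  anyBelow-false : ∀ n P → anyBelow n P ≡ false → ∀ x → x < n → P x ≡ false
  anyBelow-false n P e x x<n with P x in Px
  ... | false = refl
  ... | true  = ⊥-elim (false≢true e (anyBelow-complete n P x x<n Px))

  sumBelow : ℕ → (ℕ → ℕ) → ℕ
  sumBelow zero    f = 0
  sumBelow (suc m) f = sumBelow m f + f m

  indicator : Bool → ℕ
  indicator true  = 1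
  indicator false = 0

  count : ℕ → (ℕ → Bool) → ℕ
  count m P = sumBelow m (indicator ∘ P)

  sumBelow-cong : ∀ m {f g} → (∀ x → x < m → f x ≡ g x) → sumBelow m f ≡ sumBelow m g
  sumBelow-cong zero    _   = refl
  sumBelow-cong (suc m) f≡g = cong₂ _+_ (sumBelow-cong m (λ x x<m → f≡g x (ℕₚ.m<n⇒m<1+n x<m))) (f≡g m ℕₚ.≤-refl)

  sumBelow-mono : ∀ m {f g} → (∀ x → x < m → f x ≤ g x) → sumBelow m f ≤ sumBelow m g
  sumBelow-mono zero    _   = z≤n
  sumBelow-mono (suc m) f≤g = ℕₚ.+-mono-≤ (sumBelow-mono m (λ x x<m → f≤g x (ℕₚ.m<n⇒m<1+n x<m))) (f≤g m ℕₚ.≤-refl)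

  sumBelow-+ : ∀ m (f g : ℕ → ℕ) → sumBelow m (λ x → f x + g x) ≡ sumBelow m f + sumBelow m g
  sumBelow-+ zero    f g = refl
  sumBelow-+ (suc m) f g = trans (cong (_+ (f m + g m)) (sumBelow-+ m f g)) (interchange (sumBelow m f) (sumBelow m g) (f m) (g m))
    where interchange : ∀ a b c d → a + b + (c + d) ≡ (a + c) + (b + d)
          interchange = solve-∀

  sumBelow-*ˡ : ∀ m c (f : ℕ → ℕ) → sumBelow m (λ x → c * f x) ≡ c * sumBelow m f
  sumBelow-*ˡ zero    c f = sym (ℕₚ.*-zeroʳ c)
  sumBelow-*ˡ (suc m) c f = trans (cong (_+ c * f m) (sumBelow-*ˡ m c f)) (sym (ℕₚ.*-distribˡ-+ c (sumBelow m f) (f m)))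

  sumBelow-zero : ∀ m → sumBelow m (λ _ → 0) ≡ 0
  sumBelow-zero zero    = refl
  sumBelow-zero (suc m) = trans (ℕₚ.+-identityʳ _) (sumBelow-zero m)

  sumBelow-comm : ∀ m n (g : ℕ → ℕ → ℕ) →
                  sumBelow m (λ x → sumBelow n (λ y → g y x)) ≡ sumBelow n (λ y → sumBelow m (λ x → g y x))
  sumBelow-comm m zero    g = sumBelow-zero m
  sumBelow-comm m (suc n) g = trans (sumBelow-+ m (λ x → sumBelow n (λ y → g y x)) (g n))
                                    (cong (_+ sumBelow m (g n)) (sumBelow-comm m n g))

  sumBelow-head : ∀ m (f : ℕ → ℕ) → sumBelow (suc m) f ≡ f 0 + sumBelow m (f ∘ suc)
  sumBelow-head zero    f = ℕₚ.+-comm 0 (f 0)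
  sumBelow-head (suc m) f = trans (cong (_+ f (suc m)) (sumBelow-head m f)) (ℕₚ.+-assoc (f 0) _ _)

  count-cong : ∀ m {P Q} → (∀ x → x < m → P x ≡ Q x) → count m P ≡ count m Q
  count-cong m P≡Q = sumBelow-cong m (λ x x<m → cong indicator (P≡Q x x<m))

  count-mono : ∀ m {P Q} → (∀ x → x < m → P x ≡ true → Q x ≡ true) → count m P ≤ count m Q
  count-mono m P⇒Q = sumBelow-mono m (λ x x<m → indicator-mono (P⇒Q x x<m))
    where indicator-mono : ∀ {a b} → (a ≡ true → b ≡ true) → indicator a ≤ indicator b
          indicator-mono {false} _   = z≤n
          indicator-mono {true}  a⇒b rewrite a⇒b refl = ℕₚ.≤-refl

  count≤ : ∀ m P → count m P ≤ m
  count≤ zero    P = z≤n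
  count≤ (suc m) P = ℕₚ.≤-trans (ℕₚ.+-mono-≤ (count≤ m P) (indicator≤1 (P m))) (ℕₚ.≤-reflexive (ℕₚ.+-comm m 1))
    where indicator≤1 : ∀ b → indicator b ≤ 1
          indicator≤1 true  = ℕₚ.≤-refl
          indicator≤1 false = z≤n

  count-all : ∀ m P → (∀ x → x < m → P x ≡ true) → count m P ≡ m
  count-all zero    P _   = refl
  count-all (suc m) P all rewrite all m ℕₚ.≤-refl =
    trans (cong (_+ 1) (count-all m P (λ x x<m → all x (ℕₚ.m<n⇒m<1+n x<m)))) (ℕₚ.+-comm m 1)

  count-none : ∀ m P → (∀ x → x < m → P x ≡ false) → count m P ≡ 0
  count-none zero    P _    = refl
  count-none (suc m) P none rewrite none m ℕₚ.≤-refl =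
    trans (ℕₚ.+-identityʳ _) (count-none m P (λ x x<m → none x (ℕₚ.m<n⇒m<1+n x<m)))

  count≡m⇒all : ∀ m P → count m P ≡ m → ∀ x → x < m → P x ≡ true
  count≡m⇒all (suc m) P full x x<1+m with P m in Pm
  ... | false = ⊥-elim (ℕₚ.<-irrefl refl (s≤s (ℕₚ.≤-trans (ℕₚ.≤-reflexive (sym (trans (sym (ℕₚ.+-identityʳ _)) full))) (count≤ m P))))
  ... | true with ℕₚ.m≤n⇒m<n∨m≡n (ℕₚ.≤-pred x<1+m)
  ...   | inj₁ x<m  = count≡m⇒all m P (ℕₚ.suc-injective (trans (ℕₚ.+-comm 1 _) full)) x x<m
  ...   | inj₂ refl = Pm

  count-strict : ∀ m {P Q} → (∀ x → x < m → P x ≡ true → Q x ≡ true) →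
                 ∀ x₀ → x₀ < m → Q x₀ ≡ true → P x₀ ≡ false → suc (count m P) ≤ count m Q
  count-strict (suc m) {P} {Q} P⇒Q x₀ x₀<1+m Qx₀ ¬Px₀ with ℕₚ.m≤n⇒m<n∨m≡n (ℕₚ.≤-pred x₀<1+m)
  ... | inj₁ x₀<m = ℕₚ.+-mono-≤ (count-strict m (λ x x<m → P⇒Q x (ℕₚ.m<n⇒m<1+n x<m)) x₀ x₀<m Qx₀ ¬Px₀)
                                (count-mono 1 (λ _ _ → P⇒Q m ℕₚ.≤-refl))
  ... | inj₂ refl rewrite Qx₀ | ¬Px₀ =
    ℕₚ.≤-trans (ℕₚ.≤-reflexive (trans (cong suc (ℕₚ.+-identityʳ _)) (ℕₚ.+-comm 1 (count x₀ P))))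
               (ℕₚ.+-monoˡ-≤ 1 (count-mono x₀ (λ x x<x₀ → P⇒Q x (ℕₚ.m<n⇒m<1+n x<x₀))))

  count-pos : ∀ m P x → x < m → P x ≡ true → 1 ≤ count m P
  count-pos m P x x<m Px =
    subst (λ c → suc c ≤ count m P) (count-none m _ (λ _ _ → refl)) (count-strict m {λ _ → false} {P} (λ _ _ ()) x x<m Px refl)

  count-∨-∧ : ∀ m P Q → count m (λ x → P x ∨ Q x) + count m (λ x → P x ∧ Q x) ≡ count m P + count m Q
  count-∨-∧ m P Q = trans (sym (sumBelow-+ m _ _)) (trans (sumBelow-cong m (λ x _ → pointwise (P x) (Q x))) (sumBelow-+ m _ _))
    where pointwise : ∀ a b → indicator (a ∨ b) + indicator (a ∧ b) ≡ indicator a + indicator b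
          pointwise true  true  = refl
          pointwise true  false = refl
          pointwise false true  = refl
          pointwise false false = refl

  count-∨ : ∀ m P Q → count m (λ x → P x ∨ Q x) ≤ count m P + count m Q
  count-∨ m P Q = ℕₚ.≤-trans (ℕₚ.m≤m+n _ _) (ℕₚ.≤-reflexive (count-∨-∧ m P Q))

  count-≡ᵇ : ∀ m v → v < m → count m (v ≡ᵇ_) ≡ 1
  count-≡ᵇ (suc m) v v<1+m with ℕₚ.m≤n⇒m<n∨m≡n (ℕₚ.≤-pred v<1+m)
  ... | inj₁ v<m  rewrite ≡ᵇ-false (ℕₚ.<⇒≢ v<m) = trans (ℕₚ.+-identityʳ _) (count-≡ᵇ m v v<m)
  ... | inj₂ refl rewrite ≡ᵇ-refl v = cong (_+ 1) (count-none v _ (λ x x<v → ≡ᵇ-false (λ v≡x → ℕₚ.<-irrefl (sym v≡x) x<v)))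

  count-≡ᵇ≤1 : ∀ m r → count m (_≡ᵇ r) ≤ 1
  count-≡ᵇ≤1 zero    r = z≤n
  count-≡ᵇ≤1 (suc m) r with m ℕ.≟ r
  ... | yes refl rewrite ≡ᵇ-refl m = ℕₚ.≤-reflexive (cong (_+ 1) (count-none m _ (λ x x<m → ≡ᵇ-false (ℕₚ.<⇒≢ x<m))))
  ... | no m≢r   rewrite ≡ᵇ-false m≢r = ℕₚ.≤-trans (ℕₚ.≤-reflexive (ℕₚ.+-identityʳ _)) (count-≡ᵇ≤1 m r)

module Chowla where

  open import Data.Nat using (ℕ; zero; suc; NonZero; _+_; _*_; _∸_; _≤_; _<_; z≤n; s≤s; _≡ᵇ_)
  import Data.Nat.Properties as ℕₚ
  import Data.Nat.Divisibility as ℕ∣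
  open import Data.Nat.DivMod using (_%_; m<n⇒m%n≡m; m%n<n; n%n≡0)
  open import Data.Nat.Tactic.RingSolver using (solve-∀)
  open import Data.Bool using (Bool; true; false; _∨_; _∧_; not)
  open import Data.Bool.Properties using (∧-comm)
  open import Data.Sum using (_⊎_; inj₁; inj₂)
  open import Data.Product using (∃; _×_; _,_; proj₁)
  open import Data.Empty using (⊥-elim)
  open import Function using (_∘_)
  open import Relation.Binary.PropositionalEquality
  open Congruence
  open Counting

  count-rotate : ∀ m .{{_ : NonZero m}} P → count m (λ x → P ((x + 1) % m)) ≡ count m P
  count-rotate (suc m) P = begin
      sumBelow m (λ x → indicator (P ((x + 1) % suc m))) + indicator (P ((m + 1) % suc m))
        ≡⟨ cong₂ _+_ (sumBelow-cong m (λ x x<m → cong (indicator ∘ P) (x+1%≡1+x x<m)))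
                     (cong (indicator ∘ P) (trans (cong (_% suc m) (ℕₚ.+-comm m 1)) (n%n≡0 (suc m)))) ⟩
      sumBelow m (λ x → indicator (P (suc x))) + indicator (P 0)
        ≡⟨ ℕₚ.+-comm _ (indicator (P 0)) ⟩
      indicator (P 0) + sumBelow m (λ x → indicator (P (suc x)))
        ≡⟨ sumBelow-head m (indicator ∘ P) ⟨
      count (suc m) P ∎
    where
      open ≡-Reasoning
      x+1%≡1+x : ∀ {x} → x < m → (x + 1) % suc m ≡ suc x
      x+1%≡1+x {x} x<m = trans (cong (_% suc m) (ℕₚ.+-comm x 1)) (m<n⇒m%n≡m (s≤s x<m))

  count-translate : ∀ m .{{_ : NonZero m}} e P → count m (λ x → P ((x + e) % m)) ≡ count m P
  count-translate m zero    P = count-cong m (λ x x<m → cong P (trans (cong (_% m) (ℕₚ.+-identityʳ x)) (m<n⇒m%n≡m x<m)))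
  count-translate m (suc e) P = begin
      count m (λ x → P ((x + suc e) % m))              ≡⟨ count-cong m (λ x _ → cong P (reassociate x)) ⟩
      count m (λ x → P ((((x + 1) % m) + e) % m))      ≡⟨ count-rotate m (λ y → P ((y + e) % m)) ⟩
      count m (λ y → P ((y + e) % m))                  ≡⟨ count-translate m e P ⟩
      count m P                                        ∎
    where
      open ≡-Reasoning
      reassociate : ∀ x → (x + suc e) % m ≡ ((x + 1) % m + e) % m
      reassociate x = ≡-mod⇒%≡ m _ _ (mod-trans (mod-reflexive (trans (ℕₚ.+-suc x e) (cong (_+ e) (ℕₚ.+-comm 1 x))))
                                               (+-cong-mod (≡-mod-% (x + 1) m) (mod-refl {a = e})))

  module _ (m : ℕ) .{{_ : NonZero m}} where

    private
      %-cong : ∀ {a b} → a ≡ b mod m → a % m ≡ b % m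
      %-cong = ≡-mod⇒%≡ m _ _

      %≡self : ∀ {x} → x < m → x % m ≡ x
      %≡self = m<n⇒m%n≡m

      mod-% : ∀ a → a % m ≡ a mod m
      mod-% a = mod-sym (≡-mod-% a m)

      -- x + (m ∸ e) represents x - e modulo m
      ∸+≡0 : ∀ {e} → e ≤ m → (m ∸ e) + e ≡ 0 mod m
      ∸+≡0 e≤m = mod-trans (mod-reflexive (ℕₚ.m∸n+n≡m e≤m)) (∣⇒≡0-mod ℕ∣.∣-refl)

      undo-translation : ∀ {e x} → e ≤ m → x < m → ((x + e) % m + (m ∸ e)) % m ≡ x
      undo-translation {e} {x} e≤m x<m = trans (%-cong (begin
          (x + e) % m + (m ∸ e)  ≈⟨ +-cong-mod (mod-% (x + e)) (mod-refl {a = m ∸ e}) ⟩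
          x + e + (m ∸ e)        ≡⟨ trans (ℕₚ.+-assoc x e (m ∸ e)) (cong (x +_) (ℕₚ.+-comm e (m ∸ e))) ⟩
          x + ((m ∸ e) + e)      ≈⟨ +-cong-mod (mod-refl {a = x}) (∸+≡0 e≤m) ⟩
          x + 0                  ≡⟨ ℕₚ.+-identityʳ x ⟩
          x                      ∎)) (%≡self x<m)
        where open ≡-mod-Reasoning m

    sumset : (ℕ → Bool) → (ℕ → Bool) → ℕ → Bool
    sumset A B x = anyBelow m (λ a → A a ∧ anyBelow m (λ b → B b ∧ ((a + b) % m ≡ᵇ x)))

    sumset-intro : ∀ A B {a b} → a < m → b < m → A a ≡ true → B b ≡ true → sumset A B ((a + b) % m) ≡ true
    sumset-intro A B {a} {b} a<m b<m Aa Bb =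
      anyBelow-complete m _ a a<m (∧-intro Aa (anyBelow-complete m _ b b<m (∧-intro Bb (≡ᵇ-refl ((a + b) % m)))))

    sumset-elim : ∀ A B x → sumset A B x ≡ true →
                  ∃ λ a → ∃ λ b → a < m × b < m × A a ≡ true × B b ≡ true × (a + b) % m ≡ x
    sumset-elim A B x e with anyBelow-sound m _ e
    ... | a , a<m , ∈A with ∧-elim {A a} ∈A
    ... | Aa , ∈B with anyBelow-sound m _ ∈B
    ... | b , b<m , ∈B′ with ∧-elim {B b} ∈B′
    ... | Bb , a+b≡x = a , b , a<m , b<m , Aa , Bb , ≡ᵇ-sound _ _ a+b≡x

    ⊆-sumset : ∀ A B → B 0 ≡ true → ∀ x → x < m → A x ≡ true → sumset A B x ≡ true
    ⊆-sumset A B B0 x x<m Ax =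
      subst (λ y → sumset A B y ≡ true) (trans (cong (_% m) (ℕₚ.+-identityʳ x)) (%≡self x<m))
        (sumset-intro A B x<m (ℕₚ.≤-trans (s≤s z≤n) x<m) Ax B0)

    count-sumset-full : ∀ A B → B 0 ≡ true → count m A ≡ m → count m (sumset A B) ≡ m
    count-sumset-full A B B0 |A|≡m = ℕₚ.≤-antisym (count≤ m _)
      (ℕₚ.≤-trans (ℕₚ.≤-reflexive (sym |A|≡m)) (count-mono m (⊆-sumset A B B0)))

    InvertibleExcept0 : (ℕ → Bool) → Set
    InvertibleExcept0 B = ∀ b → b < m → B b ≡ true → b ≢ 0 → ∃ λ u → b * u ≡ 1 mod m

    ChowlaBound : (ℕ → Bool) → (ℕ → Bool) → Set
    ChowlaBound A B = count m (sumset A B) ≡ m ⊎ count m A + count m B ≤ suc (count m (sumset A B))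

    -- a₀ + j b runs through all residues, since b is invertible
    translation-closed⇒full : ∀ (A : ℕ → Bool) {b u a₀} → b * u ≡ 1 mod m → a₀ < m → A a₀ ≡ true →
                              (∀ a → a < m → A a ≡ true → A ((a + b) % m) ≡ true) →
                              ∀ x → x < m → A x ≡ true
    translation-closed⇒full A {b} {u} {a₀} bu≡1 a₀<m Aa₀ closed x x<m =
      subst (λ y → A y ≡ true) (trans (%-cong hits-x) (%≡self x<m)) (orbit (u * (x + (m ∸ a₀))))
      where
        orbit : ∀ j → A ((a₀ + j * b) % m) ≡ true
        orbit zero = subst (λ y → A y ≡ true) (sym (trans (cong (_% m) (ℕₚ.+-identityʳ a₀)) (%≡self a₀<m))) Aa₀
        orbit (suc j) = subst (λ y → A y ≡ true) (%-cong step) (closed ((a₀ + j * b) % m) (m%n<n (a₀ + j * b) m) (orbit j))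
          where step : (a₀ + j * b) % m + b ≡ a₀ + suc j * b mod m
                step = mod-trans (+-cong-mod (mod-% (a₀ + j * b)) mod-refl) (mod-reflexive (shuffle a₀ j b))
                  where shuffle : ∀ a j b → a + j * b + b ≡ a + (1 + j) * b
                        shuffle = solve-∀
        hits-x : a₀ + u * (x + (m ∸ a₀)) * b ≡ x mod m
        hits-x = begin
            a₀ + u * w * b           ≡⟨ cong (a₀ +_) (regroup u w b) ⟩
            a₀ + (b * u) * w         ≈⟨ +-cong-mod (mod-refl {a = a₀}) (*-cong-mod bu≡1 (mod-refl {a = w})) ⟩
            a₀ + 1 * w               ≡⟨ regroup′ a₀ x (m ∸ a₀) ⟩
            x + ((m ∸ a₀) + a₀)      ≈⟨ +-cong-mod (mod-refl {a = x}) (∸+≡0 (ℕₚ.<⇒≤ a₀<m)) ⟩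
            x + 0                    ≡⟨ ℕₚ.+-identityʳ x ⟩
            x                        ∎
          where
            open ≡-mod-Reasoning m
            w : ℕ
            w = x + (m ∸ a₀)
            regroup : ∀ u w b → u * w * b ≡ (b * u) * w
            regroup = solve-∀
            regroup′ : ∀ a x d → a + 1 * (x + d) ≡ x + (d + a)
            regroup′ = solve-∀

    module DysonTransform (A B : ℕ → Bool) {e : ℕ} (e<m : e < m) where

      A′ B′ : ℕ → Bool
      A′ x = A x ∨ B ((x + (m ∸ e)) % m)
      B′ x = B x ∧ A ((x + e) % m)

      sumset-shrinks : ∀ x → x < m → sumset A′ B′ x ≡ true → sumset A B x ≡ true
      sumset-shrinks x x<m x∈A′+B′ with sumset-elim A′ B′ x x∈A′+B′
      ... | a , b , a<m , b<m , A′a , B′b , a+b≡x with ∨-elim {A a} A′a | ∧-elim {B b} B′b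
      ...   | inj₁ Aa   | Bb , _    = subst (λ y → sumset A B y ≡ true) a+b≡x (sumset-intro A B a<m b<m Aa Bb)
      ...   | inj₂ Ba-e | _  , Ab+e = subst (λ y → sumset A B y ≡ true) (trans (%-cong same-sum) a+b≡x)
                                        (sumset-intro A B (m%n<n (b + e) m) (m%n<n (a + (m ∸ e)) m) Ab+e Ba-e)
        where
          same-sum : (b + e) % m + (a + (m ∸ e)) % m ≡ a + b mod m
          same-sum = begin
              (b + e) % m + (a + (m ∸ e)) % m  ≈⟨ +-cong-mod (mod-% (b + e)) (mod-% (a + (m ∸ e))) ⟩
              (b + e) + (a + (m ∸ e))          ≡⟨ regroup b e a (m ∸ e) ⟩
              (a + b) + ((m ∸ e) + e)          ≈⟨ +-cong-mod (mod-refl {a = a + b}) (∸+≡0 (ℕₚ.<⇒≤ e<m)) ⟩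
              (a + b) + 0                      ≡⟨ ℕₚ.+-identityʳ (a + b) ⟩
              a + b                            ∎
            where
              open ≡-mod-Reasoning m
              regroup : ∀ b e a d → (b + e) + (a + d) ≡ (a + b) + (d + e)
              regroup = solve-∀

      count-preserved : count m A′ + count m B′ ≡ count m A + count m B
      count-preserved = begin
          count m A′ + count m B′                                    ≡⟨ cong (count m A′ +_) |B′|≡|A∩[e+B]| ⟩
          count m A′ + count m (λ x → A x ∧ B ((x + (m ∸ e)) % m))   ≡⟨ count-∨-∧ m A _ ⟩
          count m A + count m (λ x → B ((x + (m ∸ e)) % m))          ≡⟨ cong (count m A +_) (count-translate m (m ∸ e) B) ⟩
          count m A + count m B                                      ∎
        where
          open ≡-Reasoning
          |B′|≡|A∩[e+B]| : count m B′ ≡ count m (λ x → A x ∧ B ((x + (m ∸ e)) % m))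
          |B′|≡|A∩[e+B]| = trans (count-cong m (λ x x<m → trans (∧-comm (B x) _)
                                   (cong (λ y → A ((x + e) % m) ∧ B y) (sym (undo-translation (ℕₚ.<⇒≤ e<m) x<m)))))
                                 (count-translate m e (λ x → A x ∧ B ((x + (m ∸ e)) % m)))

      B′⊆B : ∀ x → x < m → B′ x ≡ true → B x ≡ true
      B′⊆B x _ B′x = proj₁ (∧-elim {B x} B′x)

      B′0 : A e ≡ true → B 0 ≡ true → B′ 0 ≡ true
      B′0 Ae B0 = ∧-intro B0 (subst (λ y → A y ≡ true) (sym (%≡self e<m)) Ae)

      B′-smaller : ∀ {b} → b < m → B b ≡ true → A ((e + b) % m) ≡ false → suc (count m B′) ≤ count m B
      B′-smaller {b} b<m Bb e+b∉A = count-strict m B′⊆B b b<m Bb B′b≡false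
        where B′b≡false : B′ b ≡ false
              B′b≡false rewrite Bb | ℕₚ.+-comm b e | e+b∉A = refl

      B′-invertible : InvertibleExcept0 B → InvertibleExcept0 B′
      B′-invertible inv x x<m B′x = inv x x<m (B′⊆B x x<m B′x)

      bound-transfers : ChowlaBound A′ B′ → ChowlaBound A B
      bound-transfers (inj₁ full) = inj₁ (ℕₚ.≤-antisym (count≤ m _)
        (ℕₚ.≤-trans (ℕₚ.≤-reflexive (sym full)) (count-mono m sumset-shrinks)))
      bound-transfers (inj₂ bound) = inj₂ (ℕₚ.≤-trans (ℕₚ.≤-reflexive (sym count-preserved))
        (ℕₚ.≤-trans bound (s≤s (count-mono m sumset-shrinks))))

    private
      translation-closed⇒bound : ∀ A B {a₀ b} → B 0 ≡ true → InvertibleExcept0 B → a₀ < m → A a₀ ≡ true →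
                                 b < m → B b ≡ true → b ≢ 0 →
                                 (∀ a → a < m → A a ≡ true → A ((a + b) % m) ≡ true) → ChowlaBound A B
      translation-closed⇒bound A B B0 inv a₀<m Aa₀ b<m Bb b≢0 closed with inv _ b<m Bb b≢0
      ... | u , bu≡1 = inj₁ (count-sumset-full A B B0
                              (count-all m A (translation-closed⇒full A bu≡1 a₀<m Aa₀ closed)))

      ⊆0⇒bound : ∀ A B → B 0 ≡ true → (∀ x → x < m → B x ≡ true → (x ≡ᵇ 0) ≡ true) → ChowlaBound A B
      ⊆0⇒bound A B B0 B⊆0 = inj₂ (ℕₚ.≤-trans (ℕₚ.+-mono-≤ (count-mono m (⊆-sumset A B B0)) |B|≤1)
                                               (ℕₚ.≤-reflexive (ℕₚ.+-comm _ 1)))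
        where |B|≤1 : count m B ≤ 1
              |B|≤1 = ℕₚ.≤-trans (count-mono m B⊆0) (count-≡ᵇ≤1 m 0)

    -- Induction on |B| via Dyson's e-transform, as in Chowla's extension of Cauchy–Davenport.
    chowla-induction : ∀ n (A B : ℕ → Bool) → count m B ≤ n → B 0 ≡ true → InvertibleExcept0 B →
                       ∀ {a₀} → a₀ < m → A a₀ ≡ true → ChowlaBound A B
    chowla-induction zero A B |B|≤0 B0 _ a₀<m _ =
      ⊥-elim (ℕₚ.≤⇒≯ |B|≤0 (count-pos m B 0 (ℕₚ.≤-trans (s≤s z≤n) a₀<m) B0))
    chowla-induction (suc n) A B |B|≤1+n B0 inv {a₀} a₀<m Aa₀
      with anyBelow m (λ a → A a ∧ anyBelow m (λ b → B b ∧ not (A ((a + b) % m)))) in escape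
    ... | true with anyBelow-sound m _ escape
    ...   | e , e<m , found with ∧-elim {A e} found
    ...     | Ae , found′ with anyBelow-sound m _ found′
    ...       | b , b<m , found″ with ∧-elim {B b} found″
    ...         | Bb , e+b∉A =
      D.bound-transfers (chowla-induction n D.A′ D.B′ |B′|≤n (D.B′0 Ae B0) (D.B′-invertible inv) a₀<m (∨-introˡ _ Aa₀))
      where
        module D = DysonTransform A B e<m
        |B′|≤n : count m D.B′ ≤ n
        |B′|≤n = ℕₚ.≤-pred (ℕₚ.≤-trans (D.B′-smaller b<m Bb (not≡true e+b∉A)) |B|≤1+n)
    chowla-induction (suc n) A B |B|≤1+n B0 inv {a₀} a₀<m Aa₀ | false
      with anyBelow m (λ b → B b ∧ not (b ≡ᵇ 0)) in nonzero
    ... | true with anyBelow-sound m _ nonzero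
    ...   | b , b<m , found with ∧-elim {B b} found
    ...     | Bb , b≢0 = translation-closed⇒bound A B B0 inv a₀<m Aa₀ b<m Bb (λ b≡0 → false≢true (not≡true b≢0) (≡ᵇ-complete b≡0)) closed
      where
        closed : ∀ a → a < m → A a ≡ true → A ((a + b) % m) ≡ true
        closed a a<m Aa with A ((a + b) % m) in a+b∉A
        ... | true  = refl
        ... | false = ⊥-elim (false≢true (anyBelow-false m _ escape a a<m)
                        (∧-intro Aa (anyBelow-complete m _ b b<m (∧-intro Bb (cong not a+b∉A)))))
    chowla-induction (suc n) A B |B|≤1+n B0 inv a₀<m Aa₀ | false | false = ⊆0⇒bound A B B0 B⊆0
      where
        B⊆0 : ∀ x → x < m → B x ≡ true → (x ≡ᵇ 0) ≡ true
        B⊆0 x x<m Bx with x ≡ᵇ 0 in x≡0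
        ... | true  = refl
        ... | false = ⊥-elim (false≢true (anyBelow-false m _ nonzero x x<m) (∧-intro Bx (cong not x≡0)))

    chowla : ∀ (A B : ℕ → Bool) → B 0 ≡ true → InvertibleExcept0 B → ∀ {a₀} → a₀ < m → A a₀ ≡ true → ChowlaBound A B
    chowla A B = chowla-induction (count m B) A B ℕₚ.≤-refl

module LagrangeRootBound where

  open import Data.Nat as ℕ using (ℕ; zero; suc; _≤_; _<_; z≤n; _≡ᵇ_)
  import Data.Nat.Properties as ℕₚ
  open import Data.Nat.DivMod using (m<n⇒m%n≡m)
  open import Data.Nat.Primality using (Prime; prime⇒nonZero)
  open import Data.Integer as ℤ using (ℤ; +_; _+_; _-_; _*_; -_; _^_; 0ℤ; 1ℤ)
  import Data.Integer.Properties as ℤ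
  open import Data.Integer.Divisibility.Signed using (_∣_; _∣?_; ∣m∣n⇒∣m-n; ∣⇒∣ᵤ)
  open import Data.Integer.Tactic.RingSolver using (solve-∀)
  open import Data.List using (List; []; _∷_; length; replicate)
  open import Data.List.Properties using (length-replicate)
  open import Data.Bool using (Bool; true; false; _∨_)
  open import Data.Sum using (inj₁; inj₂)
  open import Data.Product using (Σ; _×_; _,_)
  open import Data.Empty using (⊥-elim)
  open import Relation.Nullary using (yes; no)
  open import Relation.Nullary.Decidable using (isYes)
  open import Relation.Binary.PropositionalEquality
  open Congruence
  open Counting
  open Primes

  -- The monic polynomial with lower coefficients c₀ ∷ c₁ ∷ … ∷ cₙ₋₁, of degree n.
  evalMonic : List ℤ → ℤ → ℤ
  evalMonic []       x = 1ℤ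
  evalMonic (c ∷ cs) x = c + x * evalMonic cs x

  divide-by-linear : ∀ c cs r → Σ (List ℤ) λ q → length q ≡ length cs ×
                     (∀ x → evalMonic (c ∷ cs) x ≡ (x - r) * evalMonic q x + evalMonic (c ∷ cs) r)
  divide-by-linear c [] r = [] , refl , λ x → identity c x r
    where identity : ∀ c x r → c + x * 1ℤ ≡ (x - r) * 1ℤ + (c + r * 1ℤ)
          identity = solve-∀
  divide-by-linear c (c′ ∷ cs) r with divide-by-linear c′ cs r
  ... | q , |q|≡|cs| , f≡ = evalMonic (c′ ∷ cs) r ∷ q , cong suc |q|≡|cs| , λ x →
        trans (cong (λ u → c + x * u) (f≡ x)) (identity c x r (evalMonic q x) (evalMonic (c′ ∷ cs) r))
    where identity : ∀ c x r Q E → c + x * ((x - r) * Q + E) ≡ (x - r) * (E + x * Q) + (c + r * E)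
          identity = solve-∀

  isRootMod : ℕ → List ℤ → ℕ → Bool
  isRootMod p f z = isYes (+ p ∣? evalMonic f (+ z))

  isRootMod-sound : ∀ p f z → isRootMod p f z ≡ true → + p ∣ evalMonic f (+ z)
  isRootMod-sound p f z _ with + p ∣? evalMonic f (+ z)
  ... | yes p∣fz = p∣fz

  isRootMod-complete : ∀ p f z → + p ∣ evalMonic f (+ z) → isRootMod p f z ≡ true
  isRootMod-complete p f z p∣fz with + p ∣? evalMonic f (+ z)
  ... | yes _   = refl
  ... | no p∤fz = ⊥-elim (p∤fz p∣fz)

  module _ {p : ℕ} (pr : Prime p) where

    private
      instance _ = prime⇒nonZero pr

      residues-≡ : ∀ {z r} → z < p → r < p → + p ∣ (+ z - + r) → z ≡ r
      residues-≡ z<p r<p p∣z-r =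
        trans (sym (m<n⇒m%n≡m z<p)) (trans (≡-mod⇒%≡ p _ _ (mod-by p∣z-r)) (m<n⇒m%n≡m r<p))

    -- the recursion is on the degree, which the quotient q shares with cs
    lagrange-degree : ∀ n f → length f ≡ n → count p (isRootMod p f) ≤ length f
    lagrange-degree _ [] _ = ℕₚ.≤-reflexive (count-none p _ (λ z _ → no-root z))
      where
        no-root : ∀ z → isRootMod p [] z ≡ false
        no-root z with + p ∣? 1ℤ
        ... | no _     = refl
        ... | yes p∣1 = ⊥-elim (prime∤1 pr (∣⇒∣ᵤ p∣1))
    lagrange-degree (suc n) (c ∷ cs) |f|≡1+n with anyBelow p (isRootMod p (c ∷ cs)) in has-root
    ... | false = ℕₚ.≤-trans (ℕₚ.≤-reflexive (count-none p _ (anyBelow-false p _ has-root))) z≤n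
    ... | true with anyBelow-sound p _ has-root
    ...   | r , r<p , f[r]≡0 with divide-by-linear c cs (+ r)
    ...     | q , |q|≡|cs| , f≡ = begin
        count p (isRootMod p (c ∷ cs))                          ≤⟨ count-mono p roots⊆ ⟩
        count p (λ z → (z ≡ᵇ r) ∨ isRootMod p q z)              ≤⟨ count-∨ p _ _ ⟩
        count p (_≡ᵇ r) ℕ.+ count p (isRootMod p q)             ≤⟨ ℕₚ.+-mono-≤ (count-≡ᵇ≤1 p r)
                                                                     (lagrange-degree n q (trans |q|≡|cs| (ℕₚ.suc-injective |f|≡1+n))) ⟩
        1 ℕ.+ length q                                          ≡⟨ cong suc |q|≡|cs| ⟩
        length (c ∷ cs)                                         ∎
      where
        open ℕₚ.≤-Reasoning
        roots⊆ : ∀ z → z < p → isRootMod p (c ∷ cs) z ≡ true → ((z ≡ᵇ r) ∨ isRootMod p q z) ≡ true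
        roots⊆ z z<p f[z]≡0 with euclidsLemmaᶻ pr (+ z - + r) (evalMonic q (+ z)) p∣[z-r]q[z]
          where
            cancel : ∀ a b c → (a * b + c) - c ≡ a * b
            cancel = solve-∀
            p∣[z-r]q[z] : + p ∣ (+ z - + r) * evalMonic q (+ z)
            p∣[z-r]q[z] = subst (+ p ∣_) (cancel (+ z - + r) (evalMonic q (+ z)) (evalMonic (c ∷ cs) (+ r)))
              (∣m∣n⇒∣m-n (subst (+ p ∣_) (f≡ (+ z)) (isRootMod-sound p (c ∷ cs) z f[z]≡0))
                         (isRootMod-sound p (c ∷ cs) r f[r]≡0))
        ... | inj₁ p∣z-r rewrite residues-≡ z<p r<p p∣z-r | ≡ᵇ-refl r = refl
        ... | inj₂ p∣q[z] = ∨-introʳ (z ≡ᵇ r) (isRootMod-complete p q z p∣q[z])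

    lagrange : ∀ f → count p (isRootMod p f) ≤ length f
    lagrange f = lagrange-degree (length f) f refl

    count-solutions-^≡ : ∀ n c (P : ℕ → Bool) → (∀ z → z < p → P z ≡ true → z ℕ.^ suc n ≡ c mod p) →
                         count p P ≤ suc n
    count-solutions-^≡ n c P solves = begin
        count p P                            ≤⟨ count-mono p P⊆roots ⟩
        count p (isRootMod p x^[1+n]-c)      ≤⟨ lagrange x^[1+n]-c ⟩
        length x^[1+n]-c                     ≡⟨ cong suc (length-replicate n) ⟩
        suc n                                ∎
      where
        open ℕₚ.≤-Reasoning
        x^[1+n]-c : List ℤ
        x^[1+n]-c = - + c ∷ replicate n 0ℤ
        eval-x^[1+n]-c : ∀ x → evalMonic x^[1+n]-c x ≡ x ^ suc n - + c
        eval-x^[1+n]-c x = trans (cong (λ u → - + c + x * u) (eval-xⁿ n)) (ℤ.+-comm (- + c) (x * x ^ n))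
          where eval-xⁿ : ∀ n → evalMonic (replicate n 0ℤ) x ≡ x ^ n
                eval-xⁿ zero    = refl
                eval-xⁿ (suc n) = trans (ℤ.+-identityˡ _) (cong (x *_) (eval-xⁿ n))
        P⊆roots : ∀ z → z < p → P z ≡ true → isRootMod p x^[1+n]-c z ≡ true
        P⊆roots z z<p Pz = isRootMod-complete p x^[1+n]-c z
          (subst (+ p ∣_) (trans (cong (_- + c) (pos-^ z (suc n))) (sym (eval-x^[1+n]-c (+ z))))
                 (modulus∣difference (solves z z<p Pz)))

module Images where

  open import Data.Nat using (ℕ; _*_; _≤_; _<_; _≡ᵇ_)
  import Data.Nat.Properties as ℕₚ
  open import Data.Bool using (Bool; true; false; _∧_)
  open import Data.Vec using (Vec; []; _∷_; map)
  open import Data.Vec.Relation.Unary.All using (All; []; _∷_)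
  open import Data.Product using (∃; _×_; _,_)
  open import Relation.Binary.PropositionalEquality
  open Counting

  image : ℕ → (ℕ → Bool) → (ℕ → ℕ) → ℕ → Bool
  image N D f x = anyBelow N (λ z → D z ∧ (f z ≡ᵇ x))

  image-intro : ∀ N (D : ℕ → Bool) f {z} → z < N → D z ≡ true → image N D f (f z) ≡ true
  image-intro N D f {z} z<N Dz = anyBelow-complete N _ z z<N (∧-intro Dz (≡ᵇ-refl (f z)))

  image-elim : ∀ N (D : ℕ → Bool) f x → image N D f x ≡ true → ∃ λ z → z < N × D z ≡ true × f z ≡ x
  image-elim N D f x x∈img with anyBelow-sound N _ x∈img
  ... | z , z<N , found with ∧-elim {D z} found
  ... | Dz , fz≡x = z , z<N , Dz , ≡ᵇ-sound _ _ fz≡x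

  images-elim : ∀ {j} N (D : ℕ → Bool) f (xs : Vec ℕ j) → All (λ x → image N D f x ≡ true) xs →
                ∃ λ zs → All (λ z → z < N × D z ≡ true) zs × map f zs ≡ xs
  images-elim N D f []       []           = [] , [] , refl
  images-elim N D f (x ∷ xs) (x∈img ∷ xs∈img) with image-elim N D f x x∈img | images-elim N D f xs xs∈img
  ... | z , z<N , Dz , fz≡x | zs , zs-ok , fzs≡xs = z ∷ zs , (z<N , Dz) ∷ zs-ok , cong₂ _∷_ fz≡x fzs≡xs

  image-mono : ∀ N {D D′ : ℕ → Bool} f → (∀ z → z < N → D z ≡ true → D′ z ≡ true) →
               ∀ x → image N D f x ≡ true → image N D′ f x ≡ true
  image-mono N f D⊆D′ x x∈img with image-elim N _ f x x∈img
  ... | z , z<N , Dz , refl = image-intro N _ f z<N (D⊆D′ z z<N Dz)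

  count≤fibre*image : ∀ N M (D : ℕ → Bool) (f : ℕ → ℕ) g → (∀ z → z < N → D z ≡ true → f z < M) →
                      (∀ z₀ → z₀ < N → D z₀ ≡ true → count N (λ z → D z ∧ (f z ≡ᵇ f z₀)) ≤ g) →
                      count N D ≤ g * count M (image N D f)
  count≤fibre*image N M D f g f<M fibre≤g = begin
      count N D                                                    ≡⟨ sumBelow-cong N one-value ⟩
      sumBelow N (λ z → sumBelow M (λ x → indicator (D z ∧ (f z ≡ᵇ x))))  ≡⟨ sumBelow-comm M N _ ⟨
      sumBelow M (λ x → count N (λ z → D z ∧ (f z ≡ᵇ x)))          ≤⟨ sumBelow-mono M (λ x _ → fibre≤ x) ⟩
      sumBelow M (λ x → g * indicator (image N D f x))             ≡⟨ sumBelow-*ˡ M g _ ⟩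
      g * count M (image N D f)                                    ∎
    where
      open ℕₚ.≤-Reasoning
      one-value : ∀ z → z < N → indicator (D z) ≡ sumBelow M (λ x → indicator (D z ∧ (f z ≡ᵇ x)))
      one-value z z<N with D z in Dz
      ... | true  = sym (count-≡ᵇ M (f z) (f<M z z<N Dz))
      ... | false = sym (sumBelow-zero M)
      fibre≤ : ∀ x → count N (λ z → D z ∧ (f z ≡ᵇ x)) ≤ g * indicator (image N D f x)
      fibre≤ x with image N D f x in x∈img
      ... | false = ℕₚ.≤-reflexive (trans (count-none N _ (anyBelow-false N _ x∈img)) (sym (ℕₚ.*-zeroʳ g)))
      ... | true with image-elim N D f x x∈img
      ...   | z₀ , z₀<N , Dz₀ , refl = ℕₚ.≤-trans (fibre≤g z₀ z₀<N Dz₀) (ℕₚ.≤-reflexive (sym (ℕₚ.*-identityʳ g)))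

module IteratedSumsets where

  open import Data.Nat using (ℕ; zero; suc; NonZero; _+_; _*_; _≤_; _<_)
  import Data.Nat.Properties as ℕₚ
  open import Data.Nat.DivMod using (_%_)
  open import Data.Nat.Tactic.RingSolver using (solve-∀)
  open import Data.Bool using (Bool; true)
  open import Data.Vec using (Vec; []; _∷_; sum)
  open import Data.Vec.Relation.Unary.All using (All; []; _∷_)
  open import Data.Sum using (_⊎_; inj₁; inj₂)
  open import Data.Product using (∃; _×_; _,_)
  open import Relation.Binary.PropositionalEquality
  open Congruence
  open Counting
  open Chowla

  module _ (m : ℕ) .{{_ : NonZero m}} (A B : ℕ → Bool) where

    iterSumset : ℕ → ℕ → Bool
    iterSumset zero    = A
    iterSumset (suc j) = sumset m (iterSumset j) B

    module _ (B0 : B 0 ≡ true) where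

      ⊆-iterSumset : ∀ j x → x < m → A x ≡ true → iterSumset j x ≡ true
      ⊆-iterSumset zero    x _   Ax = Ax
      ⊆-iterSumset (suc j) x x<m Ax = ⊆-sumset m (iterSumset j) B B0 x x<m (⊆-iterSumset j x x<m Ax)

      iterSumset-grows : InvertibleExcept0 m B → ∀ {a₀} → a₀ < m → A a₀ ≡ true → ∀ {h} → suc h ≤ count m B →
                         ∀ j → count m (iterSumset j) ≡ m ⊎ count m A + j * h ≤ count m (iterSumset j)
      iterSumset-grows inv a₀<m Aa₀ |B|>h zero = inj₂ (ℕₚ.≤-reflexive (ℕₚ.+-identityʳ _))
      iterSumset-grows inv {a₀} a₀<m Aa₀ {h} |B|>h (suc j)
        with iterSumset-grows inv a₀<m Aa₀ |B|>h j | chowla m (iterSumset j) B B0 inv a₀<m (⊆-iterSumset j a₀ a₀<m Aa₀)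
      ... | _        | inj₁ full = inj₁ full
      ... | inj₁ full | inj₂ _   = inj₁ (count-sumset-full m (iterSumset j) B B0 full)
      ... | inj₂ grown | inj₂ bound = inj₂ (ℕₚ.+-cancelʳ-≤ 1 _ _ (begin
          count m A + suc j * h + 1                 ≡⟨ regroup (count m A) j h ⟩
          (count m A + j * h) + suc h               ≤⟨ ℕₚ.+-mono-≤ grown |B|>h ⟩
          count m (iterSumset j) + count m B        ≤⟨ bound ⟩
          suc (count m (iterSumset (suc j)))        ≡⟨ ℕₚ.+-comm 1 _ ⟩
          count m (iterSumset (suc j)) + 1          ∎))
        where open ℕₚ.≤-Reasoning
              regroup : ∀ a j h → a + suc j * h + 1 ≡ (a + j * h) + suc h
              regroup = solve-∀

      iterSumset-full : InvertibleExcept0 m B → ∀ {a₀} → a₀ < m → A a₀ ≡ true → ∀ {h} → suc h ≤ count m B →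
                        ∀ j → m ≤ count m A + j * h → ∀ x → x < m → iterSumset j x ≡ true
      iterSumset-full inv a₀<m Aa₀ |B|>h j big x x<m with iterSumset-grows inv a₀<m Aa₀ |B|>h j
      ... | inj₁ full  = count≡m⇒all m _ full x x<m
      ... | inj₂ grown = count≡m⇒all m _ (ℕₚ.≤-antisym (count≤ m _) (ℕₚ.≤-trans big grown)) x x<m

    iterSumset-elim : ∀ j x → x < m → iterSumset j x ≡ true →
                      ∃ λ a → ∃ λ (bs : Vec ℕ j) → (a < m × A a ≡ true) × All (λ b → b < m × B b ≡ true) bs ×
                                                 a + sum bs ≡ x mod m
    iterSumset-elim zero    x x<m Ax = x , [] , (x<m , Ax) , [] , mod-reflexive (ℕₚ.+-identityʳ x)
    iterSumset-elim (suc j) x x<m x∈ with sumset-elim m (iterSumset j) B x x∈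
    ... | a′ , b , a′<m , b<m , a′∈ , Bb , a′+b≡x with iterSumset-elim j a′ a′<m a′∈
    ... | a , bs , a-ok , bs-ok , a+Σbs≡a′ = a , b ∷ bs , a-ok , (b<m , Bb) ∷ bs-ok , (begin
        a + (b + sum bs)   ≡⟨ regroup a b (sum bs) ⟩
        (a + sum bs) + b   ≈⟨ +-cong-mod a+Σbs≡a′ (mod-refl {a = b}) ⟩
        a′ + b             ≈⟨ ≡-mod-% (a′ + b) m ⟩
        (a′ + b) % m       ≡⟨ a′+b≡x ⟩
        x                  ∎)
      where open ≡-mod-Reasoning m
            regroup : ∀ a b c → a + (b + c) ≡ (a + c) + b
            regroup = solve-∀

module Witnesses where

  open import Defs
  open import Data.Nat as ℕ using (ℕ; zero; suc; _^_; _≤_; _<_; z≤n; s≤s)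
  open import Data.Nat.Divisibility using (_∣_; _∣?_)
  open import Data.Integer as ℤ using (ℤ; +_)
  open import Data.Integer.Divisibility.Signed using (∣⇒∣ᵤ)
  open import Data.Fin using (zero; suc)
  open import Data.Vec using (Vec; []; _∷_; lookup)
  open import Data.Vec.Relation.Unary.All as All using (All; []; _∷_)
  open import Data.List as List using (List; length)
  open import Data.List.Membership.Propositional using (_∈_)
  open import Data.List.Membership.Propositional.Properties using (∈-map⁺; ∈-concatMap⁺; ∈-filter⁺; ∈-upTo⁺)
  open import Data.List.Relation.Unary.Any as Any using (here; there)
  open import Data.Product using (_×_; _,_; proj₁; proj₂)
  open import Relation.Nullary using (¬_; Dec; _×-dec_)
  open import Relation.Nullary.Decidable using (¬?)
  open import Relation.Binary.PropositionalEquality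
  open Congruence

  InBox : ℕ → ℕ → Set
  InBox N v = 1 ≤ v × v ≤ N

  range1-complete : ∀ {N v} → InBox N v → v ∈ range1 N
  range1-complete {v = suc v} (_ , v<N) = ∈-map⁺ suc (∈-upTo⁺ v<N)

  vecsOf-complete : ∀ {A : Set} m (xs : List A) (v : Vec A m) → All (_∈ xs) v → v ∈ vecsOf m xs
  vecsOf-complete zero    xs []      []           = here refl
  vecsOf-complete (suc m) xs (x ∷ v) (x∈xs ∷ v∈xs) =
    ∈-concatMap⁺ (λ x′ → List.map (x′ ∷_) (vecsOf m xs))
      (Any.map (λ { refl → ∈-map⁺ (x ∷_) (vecsOf-complete m xs v v∈xs) }) x∈xs)

  private
    ∈⇒length>0 : ∀ {A : Set} {x : A} {xs} → x ∈ xs → 0 < length xs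
    ∈⇒length>0 (here _)  = s≤s z≤n
    ∈⇒length>0 (there _) = s≤s z≤n

  M-positive : ∀ k l t s n p h (y : Vec ℕ 4) (X : Vec (Vec ℕ t) s) →
               All (InBox (p ^ h)) y → All (All (InBox (p ^ h))) X →
               ¬ p ∣ lookup y zero ℕ.* lookup y (suc zero) →
               n ≡ᶻ + rhs k l y X mod (p ^ h) → 0 < M k l t s n p h
  M-positive k l t s n p h y X y∈box X∈box p∤y₁y₂ n≡rhs =
    ∈⇒length>0 (∈-filter⁺ condition? (y,X∈pairs) (p∤y₁y₂ , ∣⇒∣ᵤ (modulus∣difference n≡rhs)))
    where
      condition? : (yX : Vec ℕ 4 × Vec (Vec ℕ t) s) →
                   Dec (¬ p ∣ lookup (proj₁ yX) zero ℕ.* lookup (proj₁ yX) (suc zero) ×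
                        (p ^ h) ∣ ℤ.∣ n ℤ.- + rhs k l (proj₁ yX) (proj₂ yX) ∣)
      condition? (y , X) = ¬? (p ∣? (lookup y zero ℕ.* lookup y (suc zero))) ×-dec ((p ^ h) ∣? ℤ.∣ n ℤ.- + rhs k l y X ∣)
      box : List ℕ
      box = range1 (p ^ h)
      y,X∈pairs : (y , X) ∈ pairs t s (p ^ h)
      y,X∈pairs = ∈-concatMap⁺ (λ y′ → List.map (y′ ,_) (vecsOf s (vecsOf t box)))
        (Any.map (λ { refl → ∈-map⁺ (y ,_) (vecsOf-complete s _ X
                   (All.map (λ {v} v∈box → vecsOf-complete t box v (All.map range1-complete v∈box)) X∈box)) })
                 (vecsOf-complete 4 box y (All.map range1-complete y∈box)))

module UnitPowerResidues where

  open import Data.Nat using (ℕ; zero; suc; _+_; _*_; _^_; _∸_; _≤_; _<_; z≤n; s≤s; _≡ᵇ_)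
  import Data.Nat.Properties as ℕₚ
  open import Data.Nat.Primality using (Prime)
  open import Data.Bool using (Bool; true; false; _∧_)
  open import Data.Product using (_,_)
  open import Relation.Binary.PropositionalEquality
  open Congruence
  open Counting
  open Images
  open LagrangeRootBound using (count-solutions-^≡)
  open Witnesses using (InBox)

  positive : ℕ → Bool
  positive zero    = false
  positive (suc _) = true

  positive⇒>0 : ∀ {y} → positive y ≡ true → 0 < y
  positive⇒>0 {suc _} _ = s≤s z≤n

  count-positive : ∀ m → count m positive ≡ m ∸ 1
  count-positive zero          = refl
  count-positive (suc zero)    = refl
  count-positive (suc (suc m)) = trans (cong (_+ 1) (count-positive (suc m))) (ℕₚ.+-comm m 1)

  -- Each fibre of f on the p - 1 units solves y^(d+1) ≡ c, so has at most d + 1 elements by Lagrange.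
  units-image-size : ∀ {p} → Prime p → ∀ d (f : ℕ → ℕ) M → (∀ y → f y < M) →
                     (∀ {y y₀} → 0 < y → y < p → 0 < y₀ → y₀ < p → f y ≡ f y₀ → y ^ suc d ≡ y₀ ^ suc d mod p) →
                     p ∸ 1 ≤ suc d * count M (image p positive f)
  units-image-size {p} pr d f M f<M identifies = subst (_≤ suc d * count M (image p positive f)) (count-positive p)
      (count≤fibre*image p M positive f (suc d) (λ y _ _ → f<M y) fibre≤)
    where
      fibre≤ : ∀ y₀ → y₀ < p → positive y₀ ≡ true → count p (λ y → positive y ∧ (f y ≡ᵇ f y₀)) ≤ suc d
      fibre≤ y₀ y₀<p y₀>0 = count-solutions-^≡ pr d (y₀ ^ suc d) _ λ y y<p in-fibre →
        let (y>0 , fy≡fy₀) = ∧-elim {positive y} in-fibre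
        in identifies (positive⇒>0 y>0) y<p (positive⇒>0 y₀>0) y₀<p (≡ᵇ-sound _ _ fy≡fy₀)

  positive-inBox : ∀ {q z} → z < suc q → positive z ≡ true → InBox q z
  positive-inBox {z = suc z} z<1+q _ = s≤s z≤n , ℕₚ.≤-pred z<1+q

module SumsOfPowers where

  open import Defs using (T)
  open import Data.Nat using (ℕ; zero; suc; _+_; _*_; _^_; _∸_; _≤_; _<_; z≤n; s≤s)
  import Data.Nat.Properties as ℕₚ
  import Data.Nat.Divisibility as ℕ∣
  open import Data.Nat.DivMod using (_%_; m<n⇒m%n≡m; m%n<n)
  open import Data.Nat.Divisibility using (n∣m⇒m%n≡0; m%n≡0⇒n∣m)
  open import Data.Nat.Primality using (Prime; prime⇒nonZero)
  open import Data.Bool using (Bool; true; false)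
  open import Data.Vec as Vec using (Vec; []; _∷_; sum; map)
  open import Data.Vec.Properties using (map-∘)
  open import Data.Vec.Relation.Unary.All as All using (All; []; _∷_)
  open import Data.Product using (∃; _×_; _,_; proj₂)
  open import Data.Empty using (⊥-elim)
  open import Relation.Nullary using (¬_)
  open import Relation.Binary.PropositionalEquality
  open Congruence
  open Counting
  open Images
  open Chowla using (InvertibleExcept0)
  open IteratedSumsets
  open Primes using (prime≥2; prime∣^⇒∣)
  open PowersModuloPrimes using (unit-inverse)
  open UnitPowerResidues
  open Witnesses using (InBox)

  module _ {p : ℕ} (pr : Prime p) (l′ : ℕ) where

    private
      instance _ = prime⇒nonZero pr
      l : ℕ
      l = suc l′
      0<p : 0 < p
      0<p = ℕₚ.<-trans (s≤s z≤n) (prime≥2 pr)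

    powerResidue : ℕ → ℕ
    powerResidue z = z ^ l % p

    L U : ℕ → Bool
    L = image p (λ _ → true) powerResidue
    U = image p positive powerResidue

    0∈L : L 0 ≡ true
    0∈L = subst (λ x → L x ≡ true) (m<n⇒m%n≡m 0<p) (image-intro p _ powerResidue 0<p refl)

    0∉U : U 0 ≡ false
    0∉U with U 0 in 0∈U
    ... | false = refl
    ... | true with image-elim p positive powerResidue 0 0∈U
    ...   | suc z , z<p , _ , z^l≡0 = ⊥-elim (ℕₚ.<⇒≱ z<p (ℕ∣.∣⇒≤ (prime∣^⇒∣ pr (suc z) l (m%n≡0⇒n∣m _ p z^l≡0))))

    U⊆L : ∀ x → x < p → U x ≡ true → L x ≡ true
    U⊆L x _ = image-mono p powerResidue (λ _ _ _ → refl) x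

    |U|<|L| : suc (count p U) ≤ count p L
    |U|<|L| = count-strict p U⊆L 0 0<p 0∈L 0∉U

    p∸1≤l|U| : p ∸ 1 ≤ l * count p U
    p∸1≤l|U| = units-image-size pr l′ powerResidue p (λ y → m%n<n _ p)
                 (λ _ _ _ _ same → %≡⇒≡-mod p _ _ same)

    L-invertible : InvertibleExcept0 p L
    L-invertible x x<p x∈L x≢0 with image-elim p _ powerResidue x x∈L
    ... | z , _ , _ , refl with unit-inverse pr 0 p∤z^l
      where p∤z^l : ¬ ℕ∣._∣_ p (z ^ l)
            p∤z^l p∣z^l = x≢0 (n∣m⇒m%n≡0 (z ^ l) p p∣z^l)
    ...   | u , z^l*u≡1 = u , mod-trans (*-cong-mod (mod-sym (≡-mod-% (z ^ l) p)) mod-refl)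
                                        (≡ᶻ-subst refl refl (ℕₚ.*-identityʳ p) z^l*u≡1)

    module _ {t′ q : ℕ} (l≤t : l ≤ suc t′) (p≤q : p ≤ q) where

      -- p ≤ 1 + l |U| ≤ |L| + t′ |U|, so t′ Chowla steps fill ℤ/p
      every-residue-is-a-sum : ∀ x → x < p → iterSumset p L L t′ x ≡ true
      every-residue-is-a-sum = iterSumset-full p L L 0∈L L-invertible 0<p 0∈L |U|<|L| t′ (begin
          p                        ≡⟨ ℕₚ.m∸n+n≡m 0<p ⟨
          p ∸ 1 + 1                ≤⟨ ℕₚ.+-monoˡ-≤ 1 p∸1≤l|U| ⟩
          l * |U| + 1              ≤⟨ ℕₚ.+-monoˡ-≤ 1 (ℕₚ.*-monoˡ-≤ |U| l≤t) ⟩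
          suc t′ * |U| + 1         ≡⟨ ℕₚ.+-comm (suc t′ * |U|) 1 ⟩
          suc |U| + t′ * |U|       ≤⟨ ℕₚ.+-monoˡ-≤ (t′ * |U|) |U|<|L| ⟩
          count p L + t′ * |U|     ∎)
        where
          open ℕₚ.≤-Reasoning
          |U| = count p U

      private
        -- residue 0 is represented by p, so that every entry lies in [1, q]
        representative : ℕ → ℕ
        representative zero    = p
        representative (suc z) = suc z

        representative-≡ : ∀ z → representative z ^ l ≡ powerResidue z mod p
        representative-≡ z = mod-trans (^-cong-mod l (≡-representative z)) (≡-mod-% (z ^ l) p)
          where ≡-representative : ∀ z → representative z ≡ z mod p
                ≡-representative zero    = mod-trans (mod-reflexive (sym (ℕₚ.*-identityˡ p))) (multiple≡0-mod 1)
                ≡-representative (suc z) = mod-refl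

        representatives-in-box : ∀ {j} (zs : Vec ℕ j) → All (λ z → z < p × true ≡ true) zs →
                                 All (InBox q) (map representative zs)
        representatives-in-box []             []                = []
        representatives-in-box (zero  ∷ zs) (_ ∷ zs<p)          = (0<p , p≤q) ∷ representatives-in-box zs zs<p
        representatives-in-box (suc z ∷ zs) ((z<p , _) ∷ zs<p) = (s≤s z≤n , ℕₚ.≤-trans (ℕₚ.<⇒≤ z<p) p≤q) ∷ representatives-in-box zs zs<p

      sums-of-powers-cover : ∀ c → ∃ λ (X : Vec ℕ (suc t′)) → All (InBox q) X × T l X ≡ c mod p
      sums-of-powers-cover c
        with iterSumset-elim p L L t′ (c % p) (m%n<n c p) (every-residue-is-a-sum (c % p) (m%n<n c p))
      ... | a , bs , (_ , a∈L) , bs∈L , a+Σbs≡c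
        with images-elim p _ powerResidue (a ∷ bs) (a∈L ∷ All.map proj₂ bs∈L)
      ... | zs , zs<p , residues≡ = map representative zs , representatives-in-box zs zs<p , (begin
          sum (map (_^ l) (map representative zs))      ≡⟨ cong sum (map-∘ (_^ l) representative zs) ⟨
          sum (map (λ z → representative z ^ l) zs)     ≈⟨ sum-map-cong-mod _ powerResidue zs representative-≡ ⟩
          sum (map powerResidue zs)                     ≡⟨ cong sum residues≡ ⟩
          a + sum bs                                    ≈⟨ a+Σbs≡c ⟩
          c % p                                         ≈⟨ ≡-mod-% c p ⟨
          c                                             ∎)
        where open ≡-mod-Reasoning p

module Representation where

  open import Defs using (T; rhs; M)
  open import Data.Nat as ℕ using (ℕ; suc; _+_; _*_; _^_; _∸_; _≤_; _<_; z≤n; s≤s; _≡ᵇ_)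
  import Data.Nat.Properties as ℕₚ
  import Data.Nat.Divisibility as ℕ∣
  open import Data.Nat.DivMod using (_%_; m<n⇒m%n≡m; m%n<n)
  open import Data.Nat.Divisibility using (n∣m⇒m%n≡0; m%n≡0⇒n∣m)
  open import Data.Nat.Primality using (Prime; prime⇒nonZero)
  open import Data.Nat.GCD using (gcd; gcd[m,n]≢0; c*gcd[m,n]≡gcd[cm,cn])
  open import Data.Nat.Tactic.RingSolver using (solve-∀)
  open import Data.Integer using (ℤ; +_; _%ℕ_)
  open import Data.Bool using (Bool; true; false; _∧_; not)
  open import Data.Vec as Vec using (Vec; []; _∷_; sum; map)
  open import Data.Vec.Properties using (map-∘)
  open import Data.Vec.Relation.Unary.All as All using (All; []; _∷_)
  open import Data.Sum using (inj₂)
  open import Data.Product using (∃; _×_; _,_; proj₁; proj₂)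
  open import Data.Empty using (⊥-elim)
  open import Relation.Nullary using (¬_)
  open import Relation.Binary.PropositionalEquality
  open Congruence
  open Counting
  open Images
  open Chowla using (InvertibleExcept0)
  open IteratedSumsets
  open Primes using (prime≥2; prime∣^⇒∣)
  open PowersModuloPrimes using (unit-inverse; fermat-iterated; ^-≡-mod-gcd)
  open UnitPowerResidues
  open Witnesses using (InBox; M-positive)
  open SumsOfPowers using (sums-of-powers-cover)

  module _ {p : ℕ} (pr : Prime p) (g k′ : ℕ) where

    q k : ℕ
    q = p ^ suc g
    k = suc k′

    private
      instance _ = prime⇒nonZero pr
      p≤q : p ≤ q
      p≤q = ℕₚ.≤-trans (ℕₚ.≤-reflexive (sym (ℕₚ.*-identityʳ p))) (ℕₚ.*-monoʳ-≤ p (ℕₚ.m^n>0 p g))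
      2≤q : 2 ≤ q
      2≤q = ℕₚ.≤-trans (prime≥2 pr) p≤q
      instance _ = ℕ.>-nonZero (ℕₚ.<-trans (s≤s z≤n) 2≤q)

    kthPower : ℕ → ℕ
    kthPower z = z ^ k % q

    isUnit : ℕ → Bool
    isUnit z = positive z ∧ not (z % p ≡ᵇ 0)

    -- H: k-th power residues of units in [1, q]; S: those of all of [1, q], including 0 = q^k.
    H S : ℕ → Bool
    H = image (suc q) isUnit kthPower
    S = image (suc q) positive kthPower

    1∈H : H 1 ≡ true
    1∈H = subst (λ x → H x ≡ true) (trans (cong (_% q) (ℕₚ.^-zeroˡ k)) (m<n⇒m%n≡m 2≤q))
            (image-intro (suc q) isUnit kthPower (s≤s (ℕₚ.<-trans (s≤s z≤n) 2≤q))
              (cong not (≡ᵇ-false (λ 1%p≡0 → ℕₚ.1+n≢0 (trans (sym (m<n⇒m%n≡m (prime≥2 pr))) 1%p≡0)))))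

    0∈S : S 0 ≡ true
    0∈S = subst (λ x → S x ≡ true) (n∣m⇒m%n≡0 (q ^ k) q (ℕ∣.m∣m*n (q ^ k′)))
            (image-intro (suc q) positive kthPower ℕₚ.≤-refl (positive-q))
      where positive-q : positive q ≡ true
            positive-q with q | 2≤q
            ... | suc _ | _ = refl

    0∉H : H 0 ≡ false
    0∉H with H 0 in 0∈H
    ... | false = refl
    ... | true with image-elim (suc q) isUnit kthPower 0 0∈H
    ...   | z , _ , z-unit , z^k≡0 = ⊥-elim (false≢true (not≡true (proj₂ (∧-elim {positive z} z-unit))) (≡ᵇ-complete z%p≡0))
      where
        z%p≡0 : z % p ≡ 0
        z%p≡0 = n∣m⇒m%n≡0 z p (prime∣^⇒∣ pr z k (ℕ∣.∣-trans (ℕ∣.m∣m*n (p ^ g)) (m%n≡0⇒n∣m (z ^ k) q z^k≡0)))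

    H⊆S : ∀ x → x < q → H x ≡ true → S x ≡ true
    H⊆S x _ = image-mono (suc q) kthPower (λ z _ z-unit → proj₁ (∧-elim {positive z} z-unit)) x

    |H|<|S| : suc (count q H) ≤ count q S
    |H|<|S| = count-strict q H⊆S 0 (ℕₚ.<-trans (s≤s z≤n) 2≤q) 0∈S 0∉H

    kthPower≡⇒^k₀≡ : ∀ {k₀} → k ≡ k₀ * p ^ g → ∀ {y y₀} → kthPower y ≡ kthPower y₀ → y ^ k₀ ≡ y₀ ^ k₀ mod p
    kthPower≡⇒^k₀≡ {k₀} k≡k₀pᵍ {y} {y₀} same = begin
        y ^ k₀                 ≈⟨ fermat-iterated pr g (y ^ k₀) ⟨
        (y ^ k₀) ^ (p ^ g)     ≡⟨ reshape y ⟩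
        y ^ k                  ≈⟨ ≡ᶻ-weaken (ℕ∣.m∣m*n (p ^ g)) (%≡⇒≡-mod q _ _ same) ⟩
        y₀ ^ k                 ≡⟨ reshape y₀ ⟨
        (y₀ ^ k₀) ^ (p ^ g)    ≈⟨ fermat-iterated pr g (y₀ ^ k₀) ⟩
        y₀ ^ k₀                ∎
      where
        open ≡-mod-Reasoning p
        reshape : ∀ x → (x ^ k₀) ^ (p ^ g) ≡ x ^ k
        reshape x = trans (ℕₚ.^-*-assoc x k₀ (p ^ g)) (cong (x ^_) (sym k≡k₀pᵍ))

    -- The k-th powers of units in [1, p) take at least (p - 1)/gcd(k₀, p - 1) values.
    size-from-gcd : ∀ s {k₀} → k ≡ k₀ * p ^ g → p * gcd k (p ^ g * (p ∸ 1)) ≤ (s + 3) * (p ∸ 1) →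
                    q ≤ (s + 3) * count q H
    size-from-gcd s {k₀} k≡k₀pᵍ hyp = ℕₚ.*-cancelʳ-≤ q ((s + 3) * count q H) d (begin
        q * d                                  ≡⟨ ℕₚ.*-assoc p (p ^ g) d ⟩
        p * (p ^ g * d)                        ≡⟨ cong (p *_) (c*gcd[m,n]≡gcd[cm,cn] (p ^ g) k₀ (p ∸ 1)) ⟩
        p * gcd (p ^ g * k₀) (p ^ g * (p ∸ 1))  ≡⟨ cong (λ x → p * gcd x (p ^ g * (p ∸ 1))) (trans (ℕₚ.*-comm (p ^ g) k₀) (sym k≡k₀pᵍ)) ⟩
        p * gcd k (p ^ g * (p ∸ 1))            ≤⟨ hyp ⟩
        (s + 3) * (p ∸ 1)                      ≤⟨ ℕₚ.*-monoʳ-≤ (s + 3) p∸1≤d|U| ⟩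
        (s + 3) * (d * count q U)              ≤⟨ ℕₚ.*-monoʳ-≤ (s + 3) (ℕₚ.*-monoʳ-≤ d (count-mono q U⊆H)) ⟩
        (s + 3) * (d * count q H)              ≡⟨ regroup (s + 3) d (count q H) ⟩
        (s + 3) * count q H * d                ∎)
      where
        open ℕₚ.≤-Reasoning
        d : ℕ
        d = gcd k₀ (p ∸ 1)
        instance _ = ℕ.≢-nonZero (gcd[m,n]≢0 k₀ (p ∸ 1) (inj₂ (ℕₚ.m>n⇒m∸n≢0 (prime≥2 pr))))
        U : ℕ → Bool
        U = image p positive kthPower
        regroup : ∀ a d h → a * (d * h) ≡ a * h * d
        regroup = solve-∀
        p∤ : ∀ {y} → 0 < y → y < p → ¬ ℕ∣._∣_ p y
        p∤ 0<y y<p p∣y = ℕₚ.<⇒≱ y<p (ℕ∣.∣⇒≤ {{ℕ.>-nonZero 0<y}} p∣y)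
        p∸1≤d|U| : p ∸ 1 ≤ d * count q U
        p∸1≤d|U| = subst (λ e → p ∸ 1 ≤ e * count q U) (ℕₚ.suc-pred d)
          (units-image-size pr (ℕ.pred d) kthPower q (λ y → m%n<n _ q) λ {y} {y₀} 0<y y<p 0<y₀ y₀<p same →
            subst (λ e → y ^ e ≡ y₀ ^ e mod p) (sym (ℕₚ.suc-pred d))
              (^-≡-mod-gcd pr k₀ (p∤ 0<y y<p) (p∤ 0<y₀ y₀<p) (kthPower≡⇒^k₀≡ {k₀} k≡k₀pᵍ {y} {y₀} same)))
        U⊆H : ∀ x → x < q → U x ≡ true → H x ≡ true
        U⊆H x _ x∈U with image-elim p positive kthPower x x∈U
        ... | y , y<p , y>0 , refl = image-intro (suc q) isUnit kthPower (s≤s (ℕₚ.≤-trans (ℕₚ.<⇒≤ y<p) p≤q))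
              (∧-intro y>0 (cong not (≡ᵇ-false (λ y%p≡0 → p∤ (positive⇒>0 y>0) y<p (m%n≡0⇒n∣m y p y%p≡0)))))

    module _ (lift : ∀ {a b} → a ≡ b mod p → a ^ k ≡ b ^ k mod q) where

      S-invertible : InvertibleExcept0 q S
      S-invertible x x<q x∈S x≢0 with image-elim (suc q) positive kthPower x x∈S
      ... | z , _ , _ , refl with unit-inverse pr g p∤z^k
        where
          p∤z^k : ¬ ℕ∣._∣_ p (z ^ k)
          p∤z^k p∣z^k = x≢0 (n∣m⇒m%n≡0 (z ^ k) q (≡0-mod⇒∣ (lift (∣⇒≡0-mod (prime∣^⇒∣ pr z k p∣z^k)))))
      ...   | u , z^k*u≡1 = u , mod-trans (*-cong-mod (mod-sym (≡-mod-% (z ^ k) q)) mod-refl) z^k*u≡1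

      module _ {l′ t′ s : ℕ} (l≤t : suc l′ ≤ suc t′) (size : q ≤ (s + 3) * count q H) where

        private
          l t : ℕ
          l = suc l′
          t = suc t′

        H+S+⋯+S-full : ∀ x → x < q → iterSumset q H S (2 + s) x ≡ true
        H+S+⋯+S-full = iterSumset-full q H S 0∈S S-invertible 2≤q 1∈H |H|<|S| (2 + s)
                         (ℕₚ.≤-trans size (ℕₚ.≤-reflexive (regroup s (count q H))))
          where regroup : ∀ s h → (s + 3) * h ≡ h + (2 + s) * h
                regroup = solve-∀

        block : ℕ → Vec ℕ t
        block w = proj₁ (sums-of-powers-cover pr l′ l≤t p≤q w)

        block^k≡ : ∀ w → T l (block w) ^ k ≡ kthPower w mod q
        block^k≡ w = mod-trans (lift (proj₂ (proj₂ (sums-of-powers-cover pr l′ l≤t p≤q w)))) (≡-mod-% (w ^ k) q)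

        witness : ∀ n y₁ z₁ z₂ (ws : Vec ℕ s) → y₁ < suc q → isUnit y₁ ≡ true →
                  All (λ z → z < suc q × positive z ≡ true) (z₁ ∷ z₂ ∷ ws) →
                  n ≡ᶻ + (1 + (kthPower y₁ + sum (map kthPower (z₁ ∷ z₂ ∷ ws)))) mod q →
                  0 < M k l t s n p (suc g)
        witness n y₁ z₁ z₂ ws y₁<1+q y₁-unit ((z₁<1+q , z₁>0) ∷ (z₂<1+q , z₂>0) ∷ _) n≡ =
          M-positive k l t s n p (suc g) y X y∈box (blocks-in-box ws) p∤y₁*1 (≡ᶻ-trans n≡ (mod-sym rhs≡))
          where
            y : Vec ℕ 4
            y = y₁ ∷ 1 ∷ z₁ ∷ z₂ ∷ []
            X : Vec (Vec ℕ t) s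
            X = map block ws
            y₁>0,p∤y₁ : positive y₁ ≡ true × not (y₁ % p ≡ᵇ 0) ≡ true
            y₁>0,p∤y₁ = ∧-elim {positive y₁} y₁-unit
            y∈box : All (InBox q) y
            y∈box = positive-inBox y₁<1+q (proj₁ y₁>0,p∤y₁) ∷ (ℕₚ.≤-refl , ℕₚ.<⇒≤ 2≤q)
                  ∷ positive-inBox z₁<1+q z₁>0 ∷ positive-inBox z₂<1+q z₂>0 ∷ []
            blocks-in-box : ∀ {j} (vs : Vec ℕ j) → All (All (InBox q)) (map block vs)
            blocks-in-box []       = []
            blocks-in-box (v ∷ vs) = proj₁ (proj₂ (sums-of-powers-cover pr l′ l≤t p≤q v)) ∷ blocks-in-box vs
            p∤y₁*1 : ¬ ℕ∣._∣_ p (y₁ * 1)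
            p∤y₁*1 p∣y₁ = false≢true (not≡true (proj₂ y₁>0,p∤y₁))
                                     (≡ᵇ-complete (n∣m⇒m%n≡0 y₁ p (subst (ℕ∣._∣_ p) (ℕₚ.*-identityʳ y₁) p∣y₁)))
            rhs≡ : rhs k l y X ≡ 1 + (kthPower y₁ + sum (map kthPower (z₁ ∷ z₂ ∷ ws))) mod q
            rhs≡ = begin
                (y₁ ^ k + (1 ^ k + (z₁ ^ k + (z₂ ^ k + 0)))) + sum (map (λ x → T l x ^ k) (map block ws))
                  ≡⟨ cong₂ (λ u v → (y₁ ^ k + (u + (z₁ ^ k + (z₂ ^ k + 0)))) + sum v)
                           (ℕₚ.^-zeroˡ k) (sym (map-∘ (λ x → T l x ^ k) block ws)) ⟩
                (y₁ ^ k + (1 + (z₁ ^ k + (z₂ ^ k + 0)))) + sum (map (λ w → T l (block w) ^ k) ws)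
                  ≈⟨ +-cong-mod (+-cong-mod (≡-mod-% (y₁ ^ k) q) (+-cong-mod (mod-refl {a = 1})
                       (+-cong-mod (≡-mod-% (z₁ ^ k) q) (+-cong-mod (≡-mod-% (z₂ ^ k) q) mod-refl))))
                     (sum-map-cong-mod _ kthPower ws block^k≡) ⟩
                (kthPower y₁ + (1 + (kthPower z₁ + (kthPower z₂ + 0)))) + sum (map kthPower ws)
                  ≡⟨ regroup (kthPower y₁) (kthPower z₁) (kthPower z₂) (sum (map kthPower ws)) ⟩
                1 + (kthPower y₁ + (kthPower z₁ + (kthPower z₂ + sum (map kthPower ws))))  ∎
              where
                open ≡-mod-Reasoning q
                regroup : ∀ a b c d → (a + (1 + (b + (c + 0)))) + d ≡ 1 + (a + (b + (c + d)))
                regroup = solve-∀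

        -- n - 1 as a residue in [0, q)
        target : ℤ → ℕ
        target n = (n %ℕ q + (q ∸ 1)) % q

        1+target≡ : ∀ n → 1 + target n ≡ n %ℕ q mod q
        1+target≡ n = begin
            1 + (r + (q ∸ 1)) % q    ≈⟨ +-cong-mod (mod-refl {a = 1}) (≡-mod-% (r + (q ∸ 1)) q) ⟨
            1 + (r + (q ∸ 1))        ≡⟨ trans (ℕₚ.+-comm 1 _) (trans (ℕₚ.+-assoc r (q ∸ 1) 1)
                                          (cong (λ v → r + v) (ℕₚ.m∸n+n≡m (ℕₚ.<-trans (s≤s z≤n) 2≤q)))) ⟩
            r + q                    ≈⟨ +-cong-mod (mod-refl {a = r}) (mod-trans (mod-reflexive (sym (ℕₚ.*-identityˡ q))) (multiple≡0-mod 1)) ⟩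
            r + 0                    ≡⟨ ℕₚ.+-identityʳ r ⟩
            r                        ∎
          where
            open ≡-mod-Reasoning q
            r : ℕ
            r = n %ℕ q

        private
          from-witnesses : ∀ n {a} {bs : Vec ℕ (2 + s)} →
                           (∃ λ y₁ → y₁ < suc q × isUnit y₁ ≡ true × kthPower y₁ ≡ a) →
                           (∃ λ zs → All (λ z → z < suc q × positive z ≡ true) zs × map kthPower zs ≡ bs) →
                           a + sum bs ≡ target n mod q → 0 < M k l t s n p (suc g)
          from-witnesses n (y₁ , y₁<1+q , y₁-unit , refl) (z₁ ∷ z₂ ∷ ws , zs-ok , refl) a+Σbs≡target =
            witness n y₁ z₁ z₂ ws y₁<1+q y₁-unit zs-ok
              (≡ᶻ-trans (≡ᶻ-%ℕ n q) (mod-sym (mod-trans (+-cong-mod (mod-refl {a = 1}) a+Σbs≡target) (1+target≡ n))))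

          from-decomposition : ∀ n → (∃ λ a → ∃ λ (bs : Vec ℕ (2 + s)) → (a < q × H a ≡ true) ×
                                       All (λ b → b < q × S b ≡ true) bs × a + sum bs ≡ target n mod q) →
                               0 < M k l t s n p (suc g)
          from-decomposition n (a , bs , (_ , a∈H) , bs∈S , a+Σbs≡target) =
            from-witnesses n (image-elim (suc q) isUnit kthPower a a∈H)
                             (images-elim (suc q) positive kthPower bs (All.map proj₂ bs∈S)) a+Σbs≡target

        representation : ∀ n → 0 < M k l t s n p (suc g)
        representation n = from-decomposition n
          (iterSumset-elim q H S (2 + s) (target n) target<q (H+S+⋯+S-full (target n) target<q))
          where target<q = m%n<n (n %ℕ q + (q ∸ 1)) q

module TwoAdic where

  open import Data.Nat as ℕ using (ℕ; zero; suc; _+_; _*_; _^_; _≤_; _<_; z≤n; s≤s)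
  import Data.Nat.Properties as ℕₚ
  open import Data.Nat.Divisibility as ℕ∣ using (_∣_; _∣?_)
  open import Data.Nat.DivMod using (_%_; m%n<n)
  open import Data.Nat.Tactic.RingSolver using (solve-∀)
  open import Data.Integer using (+_)
  open import Data.Integer.Divisibility.Signed using (divides)
  open import Data.Empty using (⊥; ⊥-elim)
  open import Relation.Nullary using (¬_; yes; no)
  open import Relation.Binary.PropositionalEquality
  open Congruence
  open LiftingTheExponent using (lifting-the-exponent)

  ^-pres-∣ : ∀ {d a} n → d ∣ a → d ^ n ∣ a ^ n
  ^-pres-∣ zero    _   = ℕ∣.∣-refl
  ^-pres-∣ (suc n) d∣a = ℕ∣.*-pres-∣ d∣a (^-pres-∣ n d∣a)

  ^-∣-^ : ∀ a {m n} → m ≤ n → a ^ m ∣ a ^ n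
  ^-∣-^ a {m} {n} m≤n = subst (a ^ m ∣_) (trans (sym (ℕₚ.^-distribˡ-+-* a m (n ℕ.∸ m))) (cong (a ^_) (ℕₚ.m+[n∸m]≡n m≤n)))
                          (ℕ∣.m∣m*n (a ^ (n ℕ.∸ m)))

  odd²≡1-mod-8 : ∀ {x} → ¬ 2 ∣ x → x ^ 2 ≡ 1 mod 8
  odd²≡1-mod-8 {x} 2∤x = by-residue (x % 8) (m%n<n x 8) (≡-mod-% x 8)
    where
      odd-residue : ∀ {r} → x ≡ r mod 8 → 2 ∣ r → ⊥
      odd-residue x≡r 2∣r = 2∤x (≡0-mod⇒∣ (mod-trans (≡ᶻ-weaken (ℕ∣.divides 4 refl) x≡r) (∣⇒≡0-mod 2∣r)))
      by-residue : ∀ r → r < 8 → x ≡ r mod 8 → x ^ 2 ≡ 1 mod 8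
      by-residue 0 _ x≡r = ⊥-elim (odd-residue x≡r (ℕ∣.divides 0 refl))
      by-residue 1 _ x≡r = ^-cong-mod 2 x≡r
      by-residue 2 _ x≡r = ⊥-elim (odd-residue x≡r (ℕ∣.divides 1 refl))
      by-residue 3 _ x≡r = mod-trans (^-cong-mod 2 x≡r) (mod-by (divides (+ 1) refl))
      by-residue 4 _ x≡r = ⊥-elim (odd-residue x≡r (ℕ∣.divides 2 refl))
      by-residue 5 _ x≡r = mod-trans (^-cong-mod 2 x≡r) (mod-by (divides (+ 3) refl))
      by-residue 6 _ x≡r = ⊥-elim (odd-residue x≡r (ℕ∣.divides 3 refl))
      by-residue 7 _ x≡r = mod-trans (^-cong-mod 2 x≡r) (mod-by (divides (+ 6) refl))
      by-residue (suc (suc (suc (suc (suc (suc (suc (suc _)))))))) (s≤s (s≤s (s≤s (s≤s (s≤s (s≤s (s≤s (s≤s ())))))))) _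

  -- Odd squares are ≡ 1 (mod 8); each further factor 2 in the exponent lifts this one power of 2.
  ^-lifts-mod-2 : ∀ τ {k k₀} → k ≡ k₀ * 2 ^ suc τ → suc τ + 2 ≤ k →
                  ∀ {a b} → a ≡ b mod 2 → a ^ k ≡ b ^ k mod (2 ^ suc (τ + 2))
  ^-lifts-mod-2 τ {k} {k₀} k≡k₀2ᵗ γ≤k {a} {b} a≡b with 2 ∣? a
  ... | yes 2∣a = mod-trans (vanishes a 2∣a) (mod-sym (vanishes b (≡0-mod⇒∣ (mod-trans (mod-sym a≡b) (∣⇒≡0-mod 2∣a)))))
    where
      vanishes : ∀ w → 2 ∣ w → w ^ k ≡ 0 mod (2 ^ suc (τ + 2))
      vanishes w 2∣w = ∣⇒≡0-mod (ℕ∣.∣-trans (^-pres-∣ (suc (τ + 2)) 2∣w) (^-∣-^ w γ≤k))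
  ... | no 2∤a = begin
      a ^ k                         ≡⟨ reshape a ⟩
      ((a ^ 2) ^ (2 ^ τ)) ^ k₀      ≈⟨ ^-cong-mod k₀ lifted ⟩
      ((b ^ 2) ^ (2 ^ τ)) ^ k₀      ≡⟨ reshape b ⟨
      b ^ k                         ∎
    where
      open ≡-mod-Reasoning (2 ^ suc (τ + 2))
      2∤b : ¬ 2 ∣ b
      2∤b 2∣b = 2∤a (≡0-mod⇒∣ (mod-trans a≡b (∣⇒≡0-mod 2∣b)))
      reshape : ∀ w → w ^ k ≡ ((w ^ 2) ^ (2 ^ τ)) ^ k₀
      reshape w = trans (cong (w ^_) (trans k≡k₀2ᵗ (ℕₚ.*-comm k₀ (2 ^ suc τ))))
                    (trans (sym (ℕₚ.^-*-assoc w (2 ^ suc τ) k₀)) (cong (_^ k₀) (sym (ℕₚ.^-*-assoc w 2 (2 ^ τ)))))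
      lifted : (a ^ 2) ^ (2 ^ τ) ≡ (b ^ 2) ^ (2 ^ τ) mod (2 ^ suc (τ + 2))
      lifted = ≡ᶻ-subst refl refl (cong (λ e → 2 ^ suc e) (ℕₚ.+-comm 2 τ))
                 (lifting-the-exponent 2 τ 2 (mod-trans (odd²≡1-mod-8 2∤a) (mod-sym (odd²≡1-mod-8 2∤b))))

  n<2^n : ∀ n → n < 2 ^ n
  n<2^n zero    = s≤s z≤n
  n<2^n (suc n) = ℕₚ.+-mono-≤ (ℕₚ.m^n>0 2 n) (ℕₚ.≤-trans (n<2^n n) (ℕₚ.m≤m+n (2 ^ n) 0))

  n+4≤2^[n+2] : ∀ n → n + 4 ≤ 2 ^ (n + 2)
  n+4≤2^[n+2] zero    = ℕₚ.≤-refl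
  n+4≤2^[n+2] (suc n) = ℕₚ.+-mono-≤ (ℕₚ.m^n>0 2 (n + 2)) (ℕₚ.≤-trans (n+4≤2^[n+2] n) (ℕₚ.m≤m+n _ 0))

  2-adic-exponent≤k : ∀ τ {k c} → k ≡ c * 2 ^ suc τ → ¬ 2 ^ (suc τ + 1) ∣ k → 2 < k → suc τ + 2 ≤ k
  2-adic-exponent≤k τ       {c = zero}                k≡ _    2<k rewrite k≡ = ⊥-elim (ℕₚ.<⇒≱ 2<k z≤n)
  2-adic-exponent≤k zero    {c = suc zero}            k≡ _    2<k rewrite k≡ = ⊥-elim (ℕₚ.<-irrefl refl 2<k)
  2-adic-exponent≤k (suc τ) {c = suc zero}            refl _  _ =
    subst (_≤ 2 ^ suc (suc τ) + 0) (regroup τ) (ℕₚ.≤-trans (n+4≤2^[n+2] τ)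
      (ℕₚ.≤-reflexive (trans (cong (2 ^_) (ℕₚ.+-comm τ 2)) (sym (ℕₚ.+-identityʳ _)))))
    where regroup : ∀ τ → τ + 4 ≡ suc (suc τ) + 2
          regroup = solve-∀
  2-adic-exponent≤k τ       {c = suc (suc zero)}      k≡ 2ᵗ⁺²∤k _ =
    ⊥-elim (2ᵗ⁺²∤k (ℕ∣.divides 1 (trans k≡ (trans (cong (λ e → 2 * 2 ^ e) (ℕₚ.+-comm 1 τ)) (sym (ℕₚ.+-identityʳ _))))))
  2-adic-exponent≤k τ       {c = suc (suc (suc c))}   refl _  _ = begin
      suc τ + 2                    ≡⟨ regroup τ ⟩
      suc (suc τ) + 1              ≤⟨ ℕₚ.+-mono-≤ (n<2^n (suc τ)) (ℕₚ.m^n>0 2 (suc τ)) ⟩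
      2 ^ suc τ + 2 ^ suc τ        ≤⟨ ℕₚ.+-monoʳ-≤ (2 ^ suc τ) (ℕₚ.m≤m+n _ _) ⟩
      suc (suc (suc c)) * 2 ^ suc τ ∎
    where open ℕₚ.≤-Reasoning
          regroup : ∀ τ → suc τ + 2 ≡ suc (suc τ) + 1
          regroup = solve-∀

module SquaresModulo8 where

  open import Defs using (T; rhs; M)
  open import Data.Nat as ℕ using (ℕ; zero; suc; _+_; _*_; _^_; _<_; z≤n; s≤s)
  import Data.Nat.Properties as ℕₚ
  import Data.Nat.Divisibility as ℕ∣
  open import Data.Nat.DivMod using (_%_; m%n<n)
  open import Data.Nat.Tactic.RingSolver using (solve-∀)
  open import Data.Integer using (ℤ; +_; _%ℕ_)
  open import Data.Bool using (Bool; true; false; if_then_else_)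
  open import Data.Vec as Vec using (Vec; []; _∷_; replicate)
  open import Data.Vec.Relation.Unary.All using (All; []; _∷_)
  open import Data.Product using (_,_)
  open import Relation.Binary.PropositionalEquality
  open Congruence
  open Counting using (indicator)
  open Witnesses using (InBox; M-positive)

  -- Entries equal to 8 vanish modulo 8; squares contribute 4 (from 2), 1 (from 1) or 0 (from 8).
  module _ (l′ t′ s′ : ℕ) (n : ℤ) where

    private
      l t s : ℕ
      l = suc l′
      t = suc t′
      s = 2 + s′

      eights : ∀ m → Vec ℕ m
      eights m = replicate m 8

      y-four y-one : Bool → ℕ
      y-four b = if b then 2 else 8
      y-one  b = if b then 1 else 8

      block : Bool → Vec ℕ t
      block b = if b then 1 ∷ eights t′ else eights t

      8∣8^[1+e] : ∀ e → 8 ^ suc e ≡ 0 mod 8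
      8∣8^[1+e] e = ∣⇒≡0-mod (ℕ∣.m∣m*n (8 ^ e))

      T-eights≡0 : ∀ m → T l (eights m) ≡ 0 mod 8
      T-eights≡0 zero    = mod-refl
      T-eights≡0 (suc m) = +-cong-mod (8∣8^[1+e] l′) (T-eights≡0 m)

      T-block² : ∀ b → T l (block b) ^ 2 ≡ indicator b mod 8
      T-block² true  = ^-cong-mod 2 (+-cong-mod (mod-reflexive (ℕₚ.^-zeroˡ l)) (T-eights≡0 t′))
      T-block² false = ^-cong-mod 2 (T-eights≡0 t)

      padding² : ∀ m → Vec.sum (Vec.map (λ x → T l x ^ 2) (replicate m (eights t))) ≡ 0 mod 8
      padding² zero    = mod-refl
      padding² (suc m) = +-cong-mod (^-cong-mod 2 (T-eights≡0 t)) (padding² m)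

      y-four² : ∀ b → y-four b ^ 2 ≡ 4 * indicator b mod 8
      y-four² true  = mod-refl
      y-four² false = ∣⇒≡0-mod (ℕ∣.divides 8 refl)

      y-one² : ∀ b → y-one b ^ 2 ≡ indicator b mod 8
      y-one² true  = mod-refl
      y-one² false = ∣⇒≡0-mod (ℕ∣.divides 8 refl)

      value : Bool → Bool → Bool → Bool → ℕ
      value b₀ b₁ b₂ b₃ = 4 * indicator b₀ + indicator b₁ + indicator b₂ + indicator b₃

      rhs≡2+value : ∀ b₀ b₁ b₂ b₃ →
        rhs 2 l (1 ∷ 1 ∷ y-four b₀ ∷ y-one b₁ ∷ []) (block b₂ ∷ block b₃ ∷ replicate s′ (eights t)) ≡ 2 + value b₀ b₁ b₂ b₃ mod 8
      rhs≡2+value b₀ b₁ b₂ b₃ = mod-trans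
        (+-cong-mod (+-cong-mod (mod-refl {a = 1}) (+-cong-mod (mod-refl {a = 1}) (+-cong-mod (y-four² b₀) (+-cong-mod (y-one² b₁) mod-refl))))
                    (+-cong-mod (T-block² b₂) (+-cong-mod (T-block² b₃) (padding² s′))))
        (mod-reflexive (regroup (indicator b₀) (indicator b₁) (indicator b₂) (indicator b₃)))
        where regroup : ∀ a b c d → (1 + (1 + (4 * a + (b + 0)))) + (c + (d + 0)) ≡ 2 + (4 * a + b + c + d)
              regroup = solve-∀

      in-box : ∀ {v} → 0 < v → v ℕ.≤ 8 → InBox 8 v
      in-box 0<v v≤8 = 0<v , v≤8

      eights-in-box : ∀ m → All (InBox 8) (eights m)
      eights-in-box zero    = []
      eights-in-box (suc m) = in-box (s≤s z≤n) ℕₚ.≤-refl ∷ eights-in-box m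

      block-in-box : ∀ b → All (InBox 8) (block b)
      block-in-box true  = in-box (s≤s z≤n) (s≤s z≤n) ∷ eights-in-box t′
      block-in-box false = eights-in-box t

      padding-in-box : ∀ m → All (All (InBox 8)) (replicate m (eights t))
      padding-in-box zero    = []
      padding-in-box (suc m) = eights-in-box t ∷ padding-in-box m

      y-in-box : ∀ b₀ b₁ → All (InBox 8) (1 ∷ 1 ∷ y-four b₀ ∷ y-one b₁ ∷ [])
      y-in-box b₀ b₁ = in-box (s≤s z≤n) (s≤s z≤n) ∷ in-box (s≤s z≤n) (s≤s z≤n) ∷ four b₀ ∷ one b₁ ∷ []
        where four : ∀ b → InBox 8 (y-four b)
              four true  = in-box (s≤s z≤n) (s≤s (s≤s z≤n))
              four false = in-box (s≤s z≤n) ℕₚ.≤-refl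
              one : ∀ b → InBox 8 (y-one b)
              one true  = in-box (s≤s z≤n) (s≤s z≤n)
              one false = in-box (s≤s z≤n) ℕₚ.≤-refl

      -- n ≡ 2 + value, i.e. value ≡ n + 6 (mod 8)
      from-value : ∀ b₀ b₁ b₂ b₃ → value b₀ b₁ b₂ b₃ ≡ (n %ℕ 8 + 6) % 8 → 0 < M 2 l t s n 2 3
      from-value b₀ b₁ b₂ b₃ value≡ =
        M-positive 2 l t s n 2 3 (1 ∷ 1 ∷ y-four b₀ ∷ y-one b₁ ∷ []) (block b₂ ∷ block b₃ ∷ replicate s′ (eights t))
          (y-in-box b₀ b₁) (block-in-box b₂ ∷ block-in-box b₃ ∷ padding-in-box s′)
          (λ 2∣1 → ℕₚ.<-irrefl refl (ℕ∣.∣⇒≤ 2∣1))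
          (≡ᶻ-trans (≡ᶻ-%ℕ n 8) (mod-sym (begin
            rhs 2 l (1 ∷ 1 ∷ y-four b₀ ∷ y-one b₁ ∷ []) (block b₂ ∷ block b₃ ∷ replicate s′ (eights t))
                                                ≈⟨ rhs≡2+value b₀ b₁ b₂ b₃ ⟩
            2 + value b₀ b₁ b₂ b₃               ≡⟨ cong (λ v → 2 + v) value≡ ⟩
            2 + (r + 6) % 8                     ≈⟨ +-cong-mod (mod-refl {a = 2}) (≡-mod-% (r + 6) 8) ⟨
            2 + (r + 6)                         ≡⟨ regroup r ⟩
            r + 1 * 8                           ≈⟨ +-cong-mod (mod-refl {a = r}) (multiple≡0-mod 1) ⟩
            r + 0                               ≡⟨ ℕₚ.+-identityʳ r ⟩
            r                                   ∎)))
        where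
          open ≡-mod-Reasoning 8
          r : ℕ
          r = n %ℕ 8
          regroup : ∀ r → 2 + (r + 6) ≡ r + 1 * 8
          regroup = solve-∀

    k=p=2-case : 0 < M 2 l t s n 2 3
    k=p=2-case = by-residue ((n %ℕ 8 + 6) % 8) refl (m%n<n (n %ℕ 8 + 6) 8)
      where
        by-residue : ∀ v → v ≡ (n %ℕ 8 + 6) % 8 → v < 8 → 0 < M 2 l t s n 2 3
        by-residue 0 v≡ _ = from-value false false false false v≡
        by-residue 1 v≡ _ = from-value false true  false false v≡
        by-residue 2 v≡ _ = from-value false true  true  false v≡
        by-residue 3 v≡ _ = from-value false true  true  true  v≡
        by-residue 4 v≡ _ = from-value true  false false false v≡
        by-residue 5 v≡ _ = from-value true  true  false false v≡
        by-residue 6 v≡ _ = from-value true  true  true  false v≡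
        by-residue 7 v≡ _ = from-value true  true  true  true  v≡
        by-residue (suc (suc (suc (suc (suc (suc (suc (suc _)))))))) _ (s≤s (s≤s (s≤s (s≤s (s≤s (s≤s (s≤s (s≤s ()))))))))


open import Defs
open import Data.Nat using (ℕ; zero; suc; _+_; _*_; _∸_; _^_; _≤_; _<_; z≤n; s≤s)
import Data.Nat.Properties as ℕₚ
open import Data.Nat.Divisibility using (_∣_; divides; ∣⇒≤)
open import Data.Nat.GCD using (gcd)
open import Data.Nat.Primality using (Prime; prime[2])
open import Data.Integer using (ℤ)
open import Data.Product using (∃; _×_; _,_)
open import Data.Sum using (_⊎_; inj₁; inj₂)
open import Data.Empty using (⊥-elim)
open import Relation.Nullary using (¬_)
open import Relation.Binary.PropositionalEquality
open Counting using (count; count-pos)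
open PowersModuloPrimes using (^-lifts-mod-prime)
open Representation using (representation; size-from-gcd; q; H; 1∈H)
open TwoAdic using (^-lifts-mod-2; 2-adic-exponent≤k)
open SquaresModulo8 using (k=p=2-case)

4l≤t⇒l≤t : ∀ {l t} → 4 * l ≤ t → l ≤ t
4l≤t⇒l≤t {l} = ℕₚ.≤-trans (ℕₚ.m≤m+n l (3 * l))

gamma-cases : ∀ p τ → (∃ λ τ′ → p ≡ 2 × τ ≡ suc τ′) ⊎ gamma p τ ≡ τ + 1
gamma-cases 0                   τ       = inj₂ refl
gamma-cases 1                   τ       = inj₂ refl
gamma-cases 2                   zero    = inj₂ refl
gamma-cases 2                   (suc τ) = inj₁ (τ , refl , refl)
gamma-cases (suc (suc (suc p))) τ       = inj₂ refl

γ=τ+1-case : ∀ {p} → Prime p → ∀ τ k′ {l′ t′} → suc l′ ≤ suc t′ → ∀ s n → p ^ τ ∣ suc k′ →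
             p * gcd (suc k′) (p ^ τ * (p ∸ 1)) ≤ (s + 3) * (p ∸ 1) → 0 < M (suc k′) (suc l′) (suc t′) s n p (suc τ)
γ=τ+1-case pr τ k′ l≤t s n (divides k₀ k≡k₀pᵗ) gcd-bound =
  representation pr τ k′ (^-lifts-mod-prime pr τ (divides k₀ k≡k₀pᵗ)) l≤t (size-from-gcd pr τ k′ s {k₀} k≡k₀pᵗ gcd-bound) n

γ=τ+2-case : ∀ τ′ k″ {l′ t′} → suc l′ ≤ suc t′ → ∀ s n → 2 ^ suc τ′ ∣ 3 + k″ → ¬ 2 ^ (suc τ′ + 1) ∣ 3 + k″ →
             2 ^ (suc τ′ + 2) ≤ s + 3 → 0 < M (3 + k″) (suc l′) (suc t′) s n 2 (suc τ′ + 2)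
γ=τ+2-case τ′ k″ l≤t s n (divides k₀ k≡k₀2ᵗ) 2ᵗ⁺²∤k 2ᵞ≤s+3 =
  representation prime[2] (τ′ + 2) (2 + k″)
    (^-lifts-mod-2 τ′ {k₀ = k₀} k≡k₀2ᵗ (2-adic-exponent≤k τ′ {c = k₀} k≡k₀2ᵗ 2ᵗ⁺²∤k 2<k)) l≤t
    (ℕₚ.≤-trans 2ᵞ≤s+3 (ℕₚ.≤-trans (ℕₚ.≤-reflexive (sym (ℕₚ.*-identityʳ (s + 3)))) (ℕₚ.*-monoʳ-≤ (s + 3) |H|≥1))) n
  where
    2<k : 2 < 3 + k″
    2<k = s≤s (s≤s (s≤s z≤n))
    |H|≥1 : 1 ≤ count (q prime[2] (τ′ + 2) (2 + k″)) (H prime[2] (τ′ + 2) (2 + k″))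
    |H|≥1 = count-pos (q prime[2] (τ′ + 2) (2 + k″)) _ 1 (ℕₚ.*-monoʳ-≤ 2 (ℕₚ.m^n>0 2 (τ′ + 2))) (1∈H prime[2] (τ′ + 2) (2 + k″))

p=2-cases : ∀ τ′ k′ {l′ t′} → 2 ≤ suc k′ → suc l′ ≤ suc t′ → ∀ s n →
            2 ^ suc τ′ ∣ suc k′ → ¬ 2 ^ (suc τ′ + 1) ∣ suc k′ →
            (2 < suc k′ → 2 ^ (suc τ′ + 2) ≤ s + 3) → (suc k′ ≡ 2 → 2 ≤ s) → 0 < M (suc k′) (suc l′) (suc t′) s n 2 (suc τ′ + 2)
p=2-cases τ′       (suc (suc k″)) _ l≤t s n 2ᵗ∣k 2ᵗ⁺²∤k two-adic-bound _ =
  γ=τ+2-case τ′ k″ l≤t s n 2ᵗ∣k 2ᵗ⁺²∤k (two-adic-bound (s≤s (s≤s (s≤s z≤n))))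
p=2-cases zero     (suc zero) {l′} {t′} _ _ (suc (suc s′)) n _ _ _ _ = k=p=2-case l′ t′ s′ n
p=2-cases zero     (suc zero) _ _ (suc zero) _ _ _ _ s≥2 with s≥2 refl
... | s≤s ()
p=2-cases zero     (suc zero) _ _ zero       _ _ _ _ s≥2 with s≥2 refl
... | ()
p=2-cases (suc τ′) (suc zero) _ _ _ _ 2ᵗ∣2 _ _ _ =
  ⊥-elim (ℕₚ.<⇒≱ (s≤s (s≤s (s≤s z≤n)))
           (ℕₚ.≤-trans (ℕₚ.^-monoʳ-≤ 2 {2} {suc (suc τ′)} (s≤s (s≤s z≤n))) (∣⇒≤ 2ᵗ∣2)))
p=2-cases τ′       zero (s≤s ()) _ _ _ _ _ _ _

lemma3p1 : (k l t s : ℕ) (n : ℤ) (p τ : ℕ) →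
  2 ≤ k → 2 ≤ l → 4 * l ≤ t → 1 ≤ s → Prime p →
  p ^ τ ∣ k → ¬ (p ^ (τ + 1) ∣ k) →
  (gamma p τ ≡ τ + 1 → p * gcd k (p ^ τ * (p ∸ 1)) ≤ (s + 3) * (p ∸ 1)) →
  (gamma p τ ≡ τ + 2 → 2 < k → 2 ^ (τ + 2) ≤ s + 3) →
  (p ≡ 2 → k ≡ 2 → 2 ≤ s) →
  0 < M k l t s n p (gamma p τ)
lemma3p1 zero     _        _        _ _ _ _ () _ _ _ _ _ _ _ _ _
lemma3p1 (suc _)  zero     _        _ _ _ _ _ () _ _ _ _ _ _ _ _
lemma3p1 (suc _)  (suc _)  zero     _ _ _ _ _ _ () _ _ _ _ _ _ _
lemma3p1 (suc k′) (suc l′) (suc t′) s n p τ 2≤k _ 4l≤t _ pr pᵗ∣k pᵗ⁺¹∤k gcd-bound two-adic-bound k=p=2-bound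
  with gamma-cases p τ
... | inj₂ γ≡τ+1 = subst (λ γ → 0 < M (suc k′) (suc l′) (suc t′) s n p γ) (sym (trans γ≡τ+1 (ℕₚ.+-comm τ 1)))
                         (γ=τ+1-case pr τ k′ (4l≤t⇒l≤t 4l≤t) s n pᵗ∣k (gcd-bound γ≡τ+1))
... | inj₁ (τ′ , refl , refl) =
  p=2-cases τ′ k′ 2≤k (4l≤t⇒l≤t 4l≤t) s n pᵗ∣k pᵗ⁺¹∤k (two-adic-bound refl) (k=p=2-bound refl)
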